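{- Let $R=\mathrm{GR}(4,m)$ be the Galois ring of characteristic $4$ and order $4^m$. Let $n$ be an odd positive integer and let $\alpha\in R$ be a primitive $2n$th root of unity with $\alpha^n=-1$. Let $t\ge 1$ and let $C$ be a negacyclic code of length $n$ over $\mathbb{Z}_4$ whose generator polynomial $g\in\mathbb{Z}_4[x]$ satisfies $g(\alpha)=g(\alpha^3)=\dots=g(\alpha^{2t-1})=0$ in $R$. Then $C$ has minimum Lee distance at least $2t+1$.
   Context: A negacyclic code of length $n$ over $\mathbb{Z}_4$ is an ideal of $\mathbb{Z}_4[x]/\langle x^n+1\rangle$; its generator polynomial is a polynomial in $\mathbb{Z}_4[x]$ whose image generates this ideal. Codewords $c_0+c_1x+\dots+c_{n-1}x^{n-1}$ are identified with vectors in $\mathbb{Z}_4^n$. The Lee weight on $\mathbb{Z}_4$ is $w(0)=0$, $w(1)=w(3)=1$, $w(2)=2$, extended additively to vectors; the Lee distance is $d(u,v)=w(u-v)$, and the minimum Lee distance of $C$ is the minimum Lee weight of a nonzero codeword. -}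

module Defs where

open import Data.Nat using (ℕ; zero; suc; _+_; _*_; _≤_)
open import Data.Bool using (Bool; true; false; _xor_; _∧_)
open import Data.List using (List; []; _∷_; map; foldr; replicate; _++_)
open import Data.Nat.ListAction using (sum)
open import Data.Product using (∃; _×_)
open import Relation.Binary.PropositionalEquality using (_≡_)
open import Relation.Nullary using (¬_)

data ℤ₄ : Set where
  z0 z1 z2 z3 : ℤ₄

toℕ₄ : ℤ₄ → ℕ
toℕ₄ z0 = 0
toℕ₄ z1 = 1
toℕ₄ z2 = 2
toℕ₄ z3 = 3

inc₄ : ℤ₄ → ℤ₄
inc₄ z0 = z1
inc₄ z1 = z2
inc₄ z2 = z3
inc₄ z3 = z0

fromℕ₄ : ℕ → ℤ₄
fromℕ₄ zero    = z0
fromℕ₄ (suc n) = inc₄ (fromℕ₄ n)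

_+₄_ : ℤ₄ → ℤ₄ → ℤ₄
a +₄ b = fromℕ₄ (toℕ₄ a + toℕ₄ b)

_*₄_ : ℤ₄ → ℤ₄ → ℤ₄
a *₄ b = fromℕ₄ (toℕ₄ a * toℕ₄ b)

-₄_ : ℤ₄ → ℤ₄
-₄ a = fromℕ₄ (3 * toℕ₄ a)

leeW : ℤ₄ → ℕ
leeW z0 = 0
leeW z1 = 1
leeW z2 = 2
leeW z3 = 1

-- reduction ℤ₄ → 𝔽₂ (Bool with xor / ∧)
red₂ : ℤ₄ → Bool
red₂ z0 = false
red₂ z1 = true
red₂ z2 = false
red₂ z3 = true

-- Polynomials over ℤ₄: coefficient lists, lowest degree first.

Poly : Set
Poly = List ℤ₄

coeff : Poly → ℕ → ℤ₄
coeff []      _       = z0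
coeff (a ∷ p) zero    = a
coeff (a ∷ p) (suc i) = coeff p i

-- equality of polynomials (up to trailing zeros)
_≈ₚ_ : Poly → Poly → Set
p ≈ₚ q = ∀ i → coeff p i ≡ coeff q i

addP : Poly → Poly → Poly
addP []      q       = q
addP p       []      = p
addP (a ∷ p) (b ∷ q) = (a +₄ b) ∷ addP p q

negP : Poly → Poly
negP = map -₄_

mulP : Poly → Poly → Poly
mulP []      q = []
mulP (a ∷ p) q = addP (map (a *₄_) q) (z0 ∷ mulP p q)

zeroP : Poly
zeroP = []

oneP : Poly
oneP = z1 ∷ []

powP : Poly → ℕ → Poly
powP a zero    = oneP
powP a (suc k) = mulP a (powP a k)

evalP : Poly → Poly → Poly
evalP g a = foldr (λ c acc → addP (c ∷ []) (mulP a acc)) [] g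

xⁿ+1 : ℕ → Poly
xⁿ+1 n = addP oneP (replicate n z0 ++ (z1 ∷ []))

_≡_[mod_] : Poly → Poly → Poly → Set
a ≡ b [mod h ] = ∃ λ q → addP a (negP b) ≈ₚ mulP q h

Poly₂ : Set
Poly₂ = List Bool

coeff₂ : Poly₂ → ℕ → Bool
coeff₂ []      _       = false
coeff₂ (a ∷ p) zero    = a
coeff₂ (a ∷ p) (suc i) = coeff₂ p i

addP₂ : Poly₂ → Poly₂ → Poly₂
addP₂ []      q       = q
addP₂ p       []      = p
addP₂ (a ∷ p) (b ∷ q) = (a xor b) ∷ addP₂ p q

mulP₂ : Poly₂ → Poly₂ → Poly₂
mulP₂ []      q = []
mulP₂ (a ∷ p) q = addP₂ (map (a ∧_) q) (false ∷ mulP₂ p q)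

NonConst₂ : Poly₂ → Set
NonConst₂ u = ∃ λ i → 1 ≤ i × coeff₂ u i ≡ true

-- an 𝔽₂-polynomial of positive degree with no factorisation into two
-- factors of positive degree (the units of 𝔽₂[x] are the constant 1)
Irreducible₂ : Poly₂ → Set
Irreducible₂ p = NonConst₂ p ×
  (¬ (∃ λ u → ∃ λ v → NonConst₂ u × NonConst₂ v ×
        (∀ i → coeff₂ (mulP₂ u v) i ≡ coeff₂ p i)))

MonicOfDegree : Poly → ℕ → Set
MonicOfDegree h m = coeff h m ≡ z1 × (∀ i → suc m ≤ i → coeff h i ≡ z0)

-- h is a monic basic irreducible polynomial of degree m over ℤ₄;
-- then GR(4,m) = ℤ₄[x]/⟨h⟩, whose elements are represented by
-- polynomials in ℤ₄[x] modulo congruence  _≡_[mod h].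
BasicIrreducible : Poly → ℕ → Set
BasicIrreducible h m = MonicOfDegree h m × Irreducible₂ (map red₂ h)

-- c ∈ ⟨g⟩ ⊆ ℤ₄[x]/⟨xⁿ+1⟩ (codeword given by its coefficient list of length n)
InNegacyclicCode : ℕ → Poly → List ℤ₄ → Set
InNegacyclicCode n g c = ∃ λ f → c ≡ mulP f g [mod xⁿ+1 n ]

leeWeight : List ℤ₄ → ℕ
leeWeight c = sum (map leeW c)

module Submission where

-- Write  R = ℤ₄[x]/⟨h⟩ = GR(4,m)  and  F = 𝔽₂[x]/⟨h̄⟩  for its residue field, where ¯ denotes
-- reduction modulo 2, and let  c  be a nonzero codeword.
--   * Since  αⁿ = -1  and the exponents 2i-1 are odd, each  α^(2i-1)  is a root of  xⁿ+1;
--     as  c ≡ f·g  modulo  xⁿ+1,  it follows that  c(α^(2i-1)) = 0  for  1 ≤ i ≤ t.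
--   * ᾱ has multiplicative order n in F:  ᾱⁿ = 1,  and  ᾱᵈ = 1  would give  α^(2d) = 1  in R,
--     because  (1 + 2y)² = 1  over ℤ₄.
--   * BCH bound over F: a binary word of length ≤ n vanishing at the  ᾱ^(2i-1)  vanishes, by
--     the Frobenius map, at  ᾱ, ᾱ², …, ᾱ^(2t); a Vandermonde elimination then shows that it is
--     zero or has Hamming weight > 2t.
--   * If  c̄ ≠ 0,  the Lee weight of c is at least the Hamming weight of c̄.  If  c̄ = 0,  then
--     c = 2c',  the relation  2c'(α^(2i-1)) = 0  in R forces  c̄'(ᾱ^(2i-1)) = 0  in F,  and the
--     Lee weight of c is at least the Hamming weight of  c̄' ≠ 0.
-- The file develops polynomial arithmetic over an arbitrary commutative ring (instantiated at
-- ℤ₄ and 𝔽₂) and relates it to the list operations of the statement; it then treats reduction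
-- modulo 2, division and the field  𝔽₂[x]/⟨h̄⟩,  power sums and the BCH bound, the lifting facts
-- from F back to R, and Lee weights, and finally assembles the theorem.

open import Defs
open import Data.Nat using (ℕ; zero; suc; _+_; _*_; _∸_; _≤_; _<_; _%_; z≤n; s≤s)
open import Data.Nat.Properties using (*-monoʳ-<; ≤-reflexive; +-comm; +-monoʳ-≤; n≤1+n; +-identityʳ; +-suc; ≤-trans; ≤-refl; m≤m+n; m≤n+m)
open import Data.Nat.Properties using (+-mono-≤; *-comm; _≤?_; ≰⇒>; ≤-pred; <⇒≤; m+[n∸m]≡n; <-irrefl; m<m+n; <⇒≱; <-trans; ≤-<-trans; <-≤-trans; m≤n⇒m<n∨m≡n)
import Data.Nat.Properties as ℕ
open import Data.Bool using (Bool; true; false; _xor_; _∧_)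
open import Data.Bool.Properties using (xor-∧-commutativeRing)
import Data.Bool as Bool
open import Data.List using (List; []; _∷_; map; foldr; length; _++_)
import Data.List as List
open import Data.List.Properties using (length-map)
open import Data.Vec using (Vec; toList; replicate)
import Data.Vec as Vec
open import Data.Vec.Properties using (length-toList)
open import Data.Maybe using (Maybe; just; nothing)
open import Data.Product using (Σ; ∃; _×_; _,_; proj₁; proj₂)
open import Data.Sum using (_⊎_; inj₁; inj₂)
open import Data.Empty using (⊥; ⊥-elim)
open import Data.Unit using (⊤; tt)
open import Function using (id)
open import Level using (0ℓ)
open import Relation.Binary.PropositionalEquality using (_≡_; _≢_; refl; sym; trans; cong; cong₂; subst; isEquivalence; module ≡-Reasoning)
open import Relation.Binary.Structures using (IsEquivalence)
open import Relation.Binary.Bundles using (Setoid)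
open import Relation.Binary.Definitions using (DecidableEquality)
open import Relation.Nullary using (¬_; Dec; yes; no; map′; _×-dec_)
open import Relation.Nullary.Decidable using (from-yes; From-yes)
open import Algebra.Bundles using (CommutativeRing)
open import Algebra.Structures using (IsCommutativeRing)
open import Algebra.Structures.Biased using (IsCommutativeSemiringˡ)
import Algebra.Properties.Ring as RingProperties
import Algebra.Properties.CommutativeSemigroup as CommutativeSemigroupProperties
open import Tactic.RingSolver.Core.AlmostCommutativeRing using (AlmostCommutativeRing)
import Tactic.RingSolver.NonReflective as RingSolver
import Relation.Binary.Reasoning.Setoid as SetoidReasoning

-- A commutative ring whose equality is propositional, with a (partial) test for zero;
-- the test is only used by the ring solver for polynomial identities.
record CoefficientRing : Set₁ where
  infixl 6 _⊕_
  infixl 7 _⊗_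
  field
    A : Set
    _⊕_ _⊗_ : A → A → A
    ⊖_ : A → A
    𝟘 𝟙 : A
    isCommutativeRing : IsCommutativeRing _≡_ _⊕_ _⊗_ ⊖_ 𝟘 𝟙
    zero? : ∀ x → Maybe (𝟘 ≡ x)

module Polynomials (R : CoefficientRing) where
  open CoefficientRing R

  private
    module CR = IsCommutativeRing isCommutativeRing
    commRing : CommutativeRing 0ℓ 0ℓ
    commRing = record
      { Carrier = A ; _≈_ = _≡_ ; _+_ = _⊕_ ; _*_ = _⊗_ ; -_ = ⊖_ ; 0# = 𝟘 ; 1# = 𝟙
      ; isCommutativeRing = isCommutativeRing }
  open RingProperties (CommutativeRing.ring commRing) using (-0#≈0#; -‿+-comm; -‿involutive; -‿distribˡ-*)
  open CommutativeSemigroupProperties (CommutativeRing.+-commutativeSemigroup commRing) using (interchange; x∙yz≈y∙xz)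

  Pol : Set
  Pol = List A

  add : Pol → Pol → Pol
  add []      q       = q
  add (a ∷ p) []      = a ∷ p
  add (a ∷ p) (b ∷ q) = (a ⊕ b) ∷ add p q

  scale : A → Pol → Pol
  scale a = map (a ⊗_)

  mul : Pol → Pol → Pol
  mul []      q = []
  mul (a ∷ p) q = add (scale a q) (𝟘 ∷ mul p q)

  neg : Pol → Pol
  neg = map ⊖_

  one : Pol
  one = 𝟙 ∷ []

  pow : Pol → ℕ → Pol
  pow a zero    = one
  pow a (suc k) = mul a (pow a k)

  -- g(a) by Horner's rule; a ranges over polynomials, i.e. over elements of a quotient ring
  eval : Pol → Pol → Pol
  eval g a = foldr (λ c acc → add (c ∷ []) (mul a acc)) [] g

  co : Pol → ℕ → A
  co []      _       = 𝟘
  co (a ∷ p) zero    = a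
  co (a ∷ p) (suc i) = co p i

  -- equality of polynomials: equal coefficients (trailing zeros are irrelevant)
  infix 4 _≋_
  record _≋_ (p q : Pol) : Set where
    constructor mk
    field get : ∀ i → co p i ≡ co q i
  open _≋_ public

  record Cong (h a b : Pol) : Set where
    constructor cg
    field
      wit : Pol
      prf : add a (neg b) ≋ mul wit h

  co-add : ∀ p q i → co (add p q) i ≡ co p i ⊕ co q i
  co-add []      q       i       = sym (CR.+-identityˡ _)
  co-add (a ∷ p) []      i       = sym (CR.+-identityʳ _)
  co-add (a ∷ p) (b ∷ q) zero    = refl
  co-add (a ∷ p) (b ∷ q) (suc i) = co-add p q i

  co-scale : ∀ a q i → co (scale a q) i ≡ a ⊗ co q i
  co-scale a []      i       = sym (CR.zeroʳ a)
  co-scale a (b ∷ q) zero    = refl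
  co-scale a (b ∷ q) (suc i) = co-scale a q i

  co-neg : ∀ q i → co (neg q) i ≡ ⊖ co q i
  co-neg []      i       = sym -0#≈0#
  co-neg (b ∷ q) zero    = refl
  co-neg (b ∷ q) (suc i) = co-neg q i

  co-zero : ∀ i → co (𝟘 ∷ []) i ≡ 𝟘
  co-zero zero    = refl
  co-zero (suc i) = refl

  ≋-refl : ∀ {p} → p ≋ p
  ≋-refl = mk λ i → refl

  ≋-sym : ∀ {p q} → p ≋ q → q ≋ p
  ≋-sym e = mk λ i → sym (get e i)

  ≋-trans : ∀ {p q r} → p ≋ q → q ≋ r → p ≋ r
  ≋-trans e f = mk λ i → trans (get e i) (get f i)

  ≡⇒≋ : ∀ {p q} → p ≡ q → p ≋ q
  ≡⇒≋ refl = ≋-refl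

  ≋-isEquivalence : IsEquivalence _≋_
  ≋-isEquivalence = record { refl = ≋-refl ; sym = ≋-sym ; trans = ≋-trans }

  ≋-setoid : Setoid 0ℓ 0ℓ
  ≋-setoid = record { isEquivalence = ≋-isEquivalence }

  module ≋-Reasoning = SetoidReasoning ≋-setoid

  cons-cong : ∀ {a b p q} → a ≡ b → p ≋ q → (a ∷ p) ≋ (b ∷ q)
  cons-cong e f = mk λ { zero → e ; (suc i) → get f i }

  tail-≋ : ∀ {a b p q} → (a ∷ p) ≋ (b ∷ q) → p ≋ q
  tail-≋ e = mk λ i → get e (suc i)

  tail-zero : ∀ {a p} → (a ∷ p) ≋ [] → p ≋ []
  tail-zero e = mk λ i → get e (suc i)

  zero-cons : ∀ {s} → s ≋ [] → (𝟘 ∷ s) ≋ []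
  zero-cons f = mk λ { zero → refl ; (suc i) → get f i }

  add-cong : ∀ {p p' q q'} → p ≋ p' → q ≋ q' → add p q ≋ add p' q'
  add-cong {p} {p'} {q} {q'} e f = mk λ i →
    trans (co-add p q i) (trans (cong₂ _⊕_ (get e i) (get f i)) (sym (co-add p' q' i)))

  add-comm : ∀ p q → add p q ≋ add q p
  add-comm p q = mk λ i → trans (co-add p q i) (trans (CR.+-comm _ _) (sym (co-add q p i)))

  add-assoc : ∀ p q r → add (add p q) r ≋ add p (add q r)
  add-assoc p q r = mk λ i →
    trans (co-add (add p q) r i) (trans (cong (_⊕ co r i) (co-add p q i))
     (trans (CR.+-assoc _ _ _) (trans (cong (co p i ⊕_) (sym (co-add q r i))) (sym (co-add p (add q r) i)))))

  add-swap : ∀ p q r → add p (add q r) ≋ add q (add p r)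
  add-swap p q r = mk λ i →
    trans (co-add p (add q r) i) (trans (cong (co p i ⊕_) (co-add q r i))
     (trans (x∙yz≈y∙xz _ _ _) (trans (cong (co q i ⊕_) (sym (co-add p r i))) (sym (co-add q (add p r) i)))))

  add-interchange : ∀ p q r s → add (add p q) (add r s) ≋ add (add p r) (add q s)
  add-interchange p q r s = mk λ i →
    trans (co-add (add p q) (add r s) i) (trans (cong₂ _⊕_ (co-add p q i) (co-add r s i))
     (trans (interchange _ _ _ _) (trans (cong₂ _⊕_ (sym (co-add p r i)) (sym (co-add q s i))) (sym (co-add (add p r) (add q s) i)))))

  add-identityʳ : ∀ p → add p [] ≋ p
  add-identityʳ p = mk λ i → trans (co-add p [] i) (CR.+-identityʳ _)

  add-zeroˡ : ∀ p → add (𝟘 ∷ []) p ≋ p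
  add-zeroˡ p = mk λ i → trans (co-add (𝟘 ∷ []) p i) (trans (cong (_⊕ co p i) (co-zero i)) (CR.+-identityˡ _))

  add-inverseʳ : ∀ p → add p (neg p) ≋ []
  add-inverseʳ p = mk λ i → trans (co-add p (neg p) i) (trans (cong (co p i ⊕_) (co-neg p i)) (CR.-‿inverseʳ _))

  neg-cong : ∀ {p q} → p ≋ q → neg p ≋ neg q
  neg-cong {p} {q} e = mk λ i → trans (co-neg p i) (trans (cong ⊖_ (get e i)) (sym (co-neg q i)))

  neg-add : ∀ p q → neg (add p q) ≋ add (neg p) (neg q)
  neg-add p q = mk λ i → trans (co-neg (add p q) i) (trans (cong ⊖_ (co-add p q i))
    (trans (sym (-‿+-comm _ _)) (trans (cong₂ _⊕_ (sym (co-neg p i)) (sym (co-neg q i))) (sym (co-add (neg p) (neg q) i)))))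

  scale-cong : ∀ a {q q'} → q ≋ q' → scale a q ≋ scale a q'
  scale-cong a {q} {q'} e = mk λ i → trans (co-scale a q i) (trans (cong (a ⊗_) (get e i)) (sym (co-scale a q' i)))

  scale-add : ∀ a q r → scale a (add q r) ≋ add (scale a q) (scale a r)
  scale-add a q r = mk λ i → trans (co-scale a (add q r) i) (trans (cong (a ⊗_) (co-add q r i))
    (trans (CR.distribˡ _ _ _) (trans (cong₂ _⊕_ (sym (co-scale a q i)) (sym (co-scale a r i))) (sym (co-add (scale a q) (scale a r) i)))))

  scale-scale : ∀ a b r → scale (a ⊗ b) r ≋ scale a (scale b r)
  scale-scale a b r = mk λ i → trans (co-scale (a ⊗ b) r i) (trans (CR.*-assoc _ _ _)
    (trans (cong (a ⊗_) (sym (co-scale b r i))) (sym (co-scale a (scale b r) i))))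

  scale-zero : ∀ r → scale 𝟘 r ≋ []
  scale-zero r = mk λ i → trans (co-scale 𝟘 r i) (CR.zeroˡ _)

  scale-one : ∀ r → scale 𝟙 r ≋ r
  scale-one r = mk λ i → trans (co-scale 𝟙 r i) (CR.*-identityˡ _)

  scale-neg : ∀ a r → scale (⊖ a) r ≋ neg (scale a r)
  scale-neg a r = mk λ i → trans (co-scale (⊖ a) r i) (trans (sym (-‿distribˡ-* _ _))
    (trans (cong ⊖_ (sym (co-scale a r i))) (sym (co-neg (scale a r) i))))

  mul-zeroʳ : ∀ p → mul p [] ≋ []
  mul-zeroʳ []      = ≋-refl
  mul-zeroʳ (a ∷ p) = zero-cons (mul-zeroʳ p)

  mul-zeroˡ : ∀ {p} q → p ≋ [] → mul p q ≋ []
  mul-zeroˡ {[]}    q e = ≋-refl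
  mul-zeroˡ {a ∷ p} q e with get e 0
  ... | refl = ≋-trans (add-cong (scale-zero q) (zero-cons (mul-zeroˡ {p} q (tail-zero e)))) (add-identityʳ [])

  mul-congˡ : ∀ {p p'} q → p ≋ p' → mul p q ≋ mul p' q
  mul-congˡ {[]}    {[]}     q e = ≋-refl
  mul-congˡ {[]}    {b ∷ p'} q e = ≋-sym (mul-zeroˡ q (≋-sym e))
  mul-congˡ {a ∷ p} {[]}     q e = mul-zeroˡ q e
  mul-congˡ {a ∷ p} {b ∷ p'} q e with get e 0
  ... | refl = add-cong ≋-refl (cons-cong refl (mul-congˡ {p} {p'} q (tail-≋ e)))

  mul-congʳ : ∀ p {q q'} → q ≋ q' → mul p q ≋ mul p q'
  mul-congʳ []      e = ≋-refl
  mul-congʳ (a ∷ p) e = add-cong (scale-cong a e) (cons-cong refl (mul-congʳ p e))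

  mul-cong : ∀ {p p' q q'} → p ≋ p' → q ≋ q' → mul p q ≋ mul p' q'
  mul-cong {p} {p'} {q} e f = ≋-trans (mul-congˡ q e) (mul-congʳ p' f)

  mul-consʳ : ∀ p b q → mul p (b ∷ q) ≋ add (scale b p) (𝟘 ∷ mul p q)
  mul-consʳ []      b q = mk λ i → sym (co-zero i)
  mul-consʳ (a ∷ p) b q = cons-cong (cong (_⊕ 𝟘) (CR.*-comm a b))
    (≋-trans (add-cong (≋-refl {scale a q}) (mul-consʳ p b q)) (add-swap (scale a q) (scale b p) _))

  mul-comm : ∀ p q → mul p q ≋ mul q p
  mul-comm []      q = ≋-sym (mul-zeroʳ q)
  mul-comm (a ∷ p) q = ≋-trans (add-cong ≋-refl (cons-cong refl (mul-comm p q))) (≋-sym (mul-consʳ q a p))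

  mul-distribˡ : ∀ p q r → mul p (add q r) ≋ add (mul p q) (mul p r)
  mul-distribˡ []      q r = ≋-refl
  mul-distribˡ (a ∷ p) q r =
    ≋-trans (add-cong (scale-add a q r) (cons-cong (sym (CR.+-identityˡ 𝟘)) (mul-distribˡ p q r)))
            (add-interchange (scale a q) (scale a r) (𝟘 ∷ mul p q) (𝟘 ∷ mul p r))

  mul-distribʳ : ∀ p q r → mul (add p q) r ≋ add (mul p r) (mul q r)
  mul-distribʳ p q r =
    ≋-trans (mul-comm (add p q) r) (≋-trans (mul-distribˡ r p q) (add-cong (mul-comm r p) (mul-comm r q)))

  scale-mul : ∀ a q r → mul (scale a q) r ≋ scale a (mul q r)
  scale-mul a []      r = ≋-refl
  scale-mul a (b ∷ q) r =
    ≋-trans (add-cong (scale-scale a b r) (cons-cong (sym (CR.zeroʳ a)) (scale-mul a q r)))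
            (≋-sym (scale-add a (scale b r) (𝟘 ∷ mul q r)))

  mul-assoc : ∀ p q r → mul (mul p q) r ≋ mul p (mul q r)
  mul-assoc []      q r = ≋-refl
  mul-assoc (a ∷ p) q r =
    ≋-trans (mul-distribʳ (scale a q) (𝟘 ∷ mul p q) r)
      (add-cong (scale-mul a q r) (≋-trans (add-cong (scale-zero r) ≋-refl) (cons-cong refl (mul-assoc p q r))))

  mul-identityˡ : ∀ p → mul one p ≋ p
  mul-identityˡ p = ≋-trans (add-cong (scale-one p) ≋-refl)
    (mk λ i → trans (co-add p (𝟘 ∷ []) i) (trans (cong (co p i ⊕_) (co-zero i)) (CR.+-identityʳ _)))

  neg-mul : ∀ p q → mul (neg p) q ≋ neg (mul p q)
  neg-mul []      q = ≋-refl
  neg-mul (a ∷ p) q =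
    ≋-trans (add-cong (scale-neg a q) (cons-cong (sym -0#≈0#) (neg-mul p q)))
            (≋-sym (neg-add (scale a q) (𝟘 ∷ mul p q)))

  isZero? : (p : Pol) → Maybe ([] ≋ p)
  isZero? [] = just ≋-refl
  isZero? (a ∷ p) with zero? a | isZero? p
  ... | just e | just f = just (mk λ { zero → e ; (suc i) → get f i })
  ... | _      | _      = nothing

  polyRing : AlmostCommutativeRing 0ℓ 0ℓ
  polyRing = record
    { Carrier = Pol ; _≈_ = _≋_ ; _+_ = add ; _*_ = mul ; -_ = neg ; 0# = [] ; 0≟_ = isZero? ; 1# = one
    ; isAlmostCommutativeRing = record
      { isCommutativeSemiring = IsCommutativeSemiringˡ.isCommutativeSemiring semiring
      ; -‿cong = neg-cong
      ; -‿*-distribˡ = neg-mul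
      ; -‿+-comm = λ x y → ≋-sym (neg-add x y) } }
    where
    semiring : IsCommutativeSemiringˡ _≋_ add mul [] one
    semiring = record
      { +-isCommutativeMonoid = record
        { isMonoid = record
          { isSemigroup = record { isMagma = record { isEquivalence = ≋-isEquivalence ; ∙-cong = add-cong } ; assoc = add-assoc }
          ; identity = (λ x → ≋-refl) , add-identityʳ }
        ; comm = add-comm }
      ; *-isCommutativeMonoid = record
        { isMonoid = record
          { isSemigroup = record { isMagma = record { isEquivalence = ≋-isEquivalence ; ∙-cong = mul-cong } ; assoc = mul-assoc }
          ; identity = mul-identityˡ , (λ x → ≋-trans (mul-comm x one) (mul-identityˡ x)) }
        ; comm = mul-comm }
      ; distribʳ = λ x y z → mul-distribʳ y z x
      ; zeroˡ = λ x → ≋-refl }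

  mul-identityʳ : ∀ p → mul p one ≋ p
  mul-identityʳ p = ≋-trans (mul-comm p one) (mul-identityˡ p)

  mul-constˡ : ∀ b {q} r → q ≋ [] → mul (b ∷ q) r ≋ scale b r
  mul-constˡ b r q≋0 = ≋-trans (add-cong (≋-refl {scale b r}) (zero-cons (mul-zeroˡ r q≋0))) (add-identityʳ (scale b r))

  mul-swap : ∀ a b c → mul a (mul b c) ≋ mul b (mul a c)
  mul-swap a b c = ≋-trans (≋-sym (mul-assoc a b c)) (≋-trans (mul-congˡ c (mul-comm a b)) (mul-assoc b a c))

  mul-interchange : ∀ a b c d → mul (mul a b) (mul c d) ≋ mul (mul a c) (mul b d)
  mul-interchange a b c d =
    ≋-trans (mul-assoc a b (mul c d)) (≋-trans (mul-congʳ a (mul-swap b c d)) (≋-sym (mul-assoc a c (mul b d))))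

  neg-mulʳ : ∀ p q → mul p (neg q) ≋ neg (mul p q)
  neg-mulʳ p q = ≋-trans (mul-comm p (neg q)) (≋-trans (neg-mul q p) (neg-cong (mul-comm q p)))

  neg-involutive : ∀ p → neg (neg p) ≋ p
  neg-involutive p = mk λ i → trans (co-neg (neg p) i) (trans (cong ⊖_ (co-neg p i)) (-‿involutive _))

  sub-chain : ∀ a b c → add (add a (neg b)) (add b (neg c)) ≋ add a (neg c)
  sub-chain a b c = begin
    add (add a (neg b)) (add b (neg c))     ≈⟨ add-assoc a (neg b) (add b (neg c)) ⟩
    add a (add (neg b) (add b (neg c)))     ≈⟨ add-cong (≋-refl {a}) (add-assoc (neg b) b (neg c)) ⟨
    add a (add (add (neg b) b) (neg c))     ≈⟨ add-cong (≋-refl {a}) (add-cong (≋-trans (add-comm (neg b) b) (add-inverseʳ b)) (≋-refl {neg c})) ⟩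
    add a (neg c)                           ∎
    where open ≋-Reasoning

  module _ (h : Pol) where
    open ≋-Reasoning

    C-resp : ∀ {a a' b b'} → a ≋ a' → b ≋ b' → Cong h a b → Cong h a' b'
    C-resp e f (cg q g) = cg q (≋-trans (add-cong (≋-sym e) (neg-cong (≋-sym f))) g)

    C-refl : ∀ {a} → Cong h a a
    C-refl {a} = cg [] (add-inverseʳ a)

    C-sym : ∀ {a b} → Cong h a b → Cong h b a
    C-sym {a} {b} (cg q e) = cg (neg q) (begin
      add b (neg a)               ≈⟨ add-comm b (neg a) ⟩
      add (neg a) b               ≈⟨ add-cong ≋-refl (neg-involutive b) ⟨
      add (neg a) (neg (neg b))   ≈⟨ neg-add a (neg b) ⟨
      neg (add a (neg b))         ≈⟨ neg-cong e ⟩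
      neg (mul q h)          ≈⟨ neg-mul q h ⟨
      mul (neg q) h          ∎)

    C-trans : ∀ {a b c} → Cong h a b → Cong h b c → Cong h a c
    C-trans {a} {b} {c} (cg q e) (cg r f) = cg (add q r) (begin
      add a (neg c)                               ≈⟨ sub-chain a b c ⟨
      add (add a (neg b)) (add b (neg c))         ≈⟨ add-cong e f ⟩
      add (mul q h) (mul r h)                     ≈⟨ mul-distribʳ q r h ⟨
      mul (add q r) h                             ∎)

    C-add : ∀ {a b c d} → Cong h a b → Cong h c d → Cong h (add a c) (add b d)
    C-add {a} {b} {c} {d} (cg q e) (cg r f) = cg (add q r) (begin
      add (add a c) (neg (add b d))               ≈⟨ add-cong ≋-refl (neg-add b d) ⟩
      add (add a c) (add (neg b) (neg d))         ≈⟨ add-interchange a c (neg b) (neg d) ⟩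
      add (add a (neg b)) (add c (neg d))         ≈⟨ add-cong e f ⟩
      add (mul q h) (mul r h)                     ≈⟨ mul-distribʳ q r h ⟨
      mul (add q r) h                             ∎)

    C-mul : ∀ {a b c d} → Cong h a b → Cong h c d → Cong h (mul a c) (mul b d)
    C-mul {a} {b} {c} {d} (cg q e) (cg r f) = cg (add (mul q c) (mul b r)) (begin
      add (mul a c) (neg (mul b d))
        ≈⟨ sub-chain (mul a c) (mul b c) (mul b d) ⟨
      add (add (mul a c) (neg (mul b c))) (add (mul b c) (neg (mul b d)))
        ≈⟨ add-cong (≋-sym (≋-trans (mul-distribʳ a (neg b) c) (add-cong ≋-refl (neg-mul b c))))
                    (≋-sym (≋-trans (mul-distribˡ b c (neg d)) (add-cong ≋-refl (neg-mulʳ b d)))) ⟩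
      add (mul (add a (neg b)) c) (mul b (add c (neg d)))
        ≈⟨ add-cong (mul-congˡ c e) (mul-congʳ b f) ⟩
      add (mul (mul q h) c) (mul b (mul r h))
        ≈⟨ add-cong (≋-trans (mul-assoc q h c) (≋-trans (mul-congʳ q (mul-comm h c)) (≋-sym (mul-assoc q c h))))
                    (≋-sym (mul-assoc b r h)) ⟩
      add (mul (mul q c) h) (mul (mul b r) h)
        ≈⟨ mul-distribʳ (mul q c) (mul b r) h ⟨
      mul (add (mul q c) (mul b r)) h
        ∎)

    C-pow : ∀ {a b} k → Cong h a b → Cong h (pow a k) (pow b k)
    C-pow zero    e = C-refl
    C-pow (suc k) e = C-mul e (C-pow k e)

    C-multiple : ∀ q → Cong h (mul q h) []
    C-multiple q = cg q (add-identityʳ (mul q h))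

    C-absorb : ∀ b {a} → Cong h a [] → Cong h (mul b a) []
    C-absorb b e = C-resp ≋-refl (mul-zeroʳ b) (C-mul (C-refl {b}) e)

  pow-add : ∀ a m k → pow a (m + k) ≋ mul (pow a m) (pow a k)
  pow-add a zero    k = ≋-sym (mul-identityˡ (pow a k))
  pow-add a (suc m) k = ≋-trans (mul-congʳ a (pow-add a m k)) (≋-sym (mul-assoc a (pow a m) (pow a k)))

  pow-distrib-mul : ∀ a b k → pow (mul a b) k ≋ mul (pow a k) (pow b k)
  pow-distrib-mul a b zero    = ≋-sym (mul-identityˡ one)
  pow-distrib-mul a b (suc k) =
    ≋-trans (mul-congʳ (mul a b) (pow-distrib-mul a b k)) (mul-interchange a b (pow a k) (pow b k))

  pow-mul : ∀ a m k → pow a (m * k) ≋ pow (pow a m) k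
  pow-mul a zero    k = ≋-sym (pow-one k)
    where
    pow-one : ∀ k → pow one k ≋ one
    pow-one zero    = ≋-refl
    pow-one (suc k) = ≋-trans (mul-identityˡ (pow one k)) (pow-one k)
  pow-mul a (suc m) k =
    ≋-trans (pow-add a k (m * k)) (≋-trans (mul-congʳ (pow a k) (pow-mul a m k)) (≋-sym (pow-distrib-mul a (pow a m) k)))

  pow-pow-comm : ∀ a j s → pow (pow a j) s ≋ pow (pow a s) j
  pow-pow-comm a j s = ≋-trans (≋-sym (pow-mul a j s)) (≋-trans (≡⇒≋ (cong (pow a) (*-comm j s))) (pow-mul a s j))

  eval-zero : ∀ {g} a → g ≋ [] → eval g a ≋ []
  eval-zero {[]}    a e = ≋-refl
  eval-zero {c ∷ g} a e with get e 0
  ... | refl = ≋-trans (add-zeroˡ _) (≋-trans (mul-congʳ a (eval-zero {g} a (tail-zero e))) (mul-zeroʳ a))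

  eval-congˡ : ∀ {g g'} a → g ≋ g' → eval g a ≋ eval g' a
  eval-congˡ {[]}    {[]}     a e = ≋-refl
  eval-congˡ {[]}    {c ∷ g'} a e = ≋-sym (eval-zero a (≋-sym e))
  eval-congˡ {c ∷ g} {[]}     a e = eval-zero a e
  eval-congˡ {c ∷ g} {d ∷ g'} a e with get e 0
  ... | refl = add-cong ≋-refl (mul-congʳ a (eval-congˡ {g} {g'} a (tail-≋ e)))

  eval-congʳ : ∀ g {a a'} → a ≋ a' → eval g a ≋ eval g a'
  eval-congʳ []      e = ≋-refl
  eval-congʳ (c ∷ g) e = add-cong ≋-refl (mul-cong e (eval-congʳ g e))

  eval-add : ∀ p q a → eval (add p q) a ≋ add (eval p a) (eval q a)
  eval-add []      q       a = ≋-refl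
  eval-add (c ∷ p) []      a = ≋-sym (add-identityʳ _)
  eval-add (c ∷ p) (d ∷ q) a =
    ≋-trans (add-cong ≋-refl (≋-trans (mul-congʳ a (eval-add p q a)) (mul-distribˡ a (eval p a) (eval q a))))
            (add-interchange (c ∷ []) (d ∷ []) (mul a (eval p a)) (mul a (eval q a)))

  scale-as-mul : ∀ b p → scale b p ≋ mul (b ∷ []) p
  scale-as-mul b p = ≋-sym (≋-trans (add-cong ≋-refl (add-zeroˡ [])) (add-identityʳ _))

  eval-const : ∀ c a → eval (c ∷ []) a ≋ (c ∷ [])
  eval-const c a = ≋-trans (add-cong ≋-refl (mul-zeroʳ a)) (add-identityʳ (c ∷ []))

  eval-one : ∀ a → eval one a ≋ one
  eval-one = eval-const 𝟙

  eval-mul : ∀ p q a → eval (mul p q) a ≋ mul (eval p a) (eval q a)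
  eval-mul []      q a = ≋-refl
  eval-mul (c ∷ p) q a = begin
    eval (add (scale c q) (𝟘 ∷ mul p q)) a
      ≈⟨ eval-add (scale c q) (𝟘 ∷ mul p q) a ⟩
    add (eval (scale c q) a) (add (𝟘 ∷ []) (mul a (eval (mul p q) a)))
      ≈⟨ add-cong (eval-scale c q) (≋-trans (add-zeroˡ _) (mul-congʳ a (eval-mul p q a))) ⟩
    add (mul (c ∷ []) (eval q a)) (mul a (mul (eval p a) (eval q a)))
      ≈⟨ add-cong ≋-refl (mul-assoc a (eval p a) (eval q a)) ⟨
    add (mul (c ∷ []) (eval q a)) (mul (mul a (eval p a)) (eval q a))
      ≈⟨ mul-distribʳ (c ∷ []) (mul a (eval p a)) (eval q a) ⟨
    mul (eval (c ∷ p) a) (eval q a)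
      ∎
    where
    open ≋-Reasoning
    eval-scale : ∀ b p → eval (scale b p) a ≋ mul (b ∷ []) (eval p a)
    eval-scale b []      = ≋-sym (mul-zeroʳ (b ∷ []))
    eval-scale b (c ∷ p) = begin
      add ((b ⊗ c) ∷ []) (mul a (eval (scale b p) a))                ≈⟨ add-cong (scale-as-mul b (c ∷ [])) (mul-congʳ a (eval-scale b p)) ⟩
      add (mul (b ∷ []) (c ∷ [])) (mul a (mul (b ∷ []) (eval p a)))   ≈⟨ add-cong ≋-refl (mul-swap a (b ∷ []) (eval p a)) ⟩
      add (mul (b ∷ []) (c ∷ [])) (mul (b ∷ []) (mul a (eval p a)))   ≈⟨ mul-distribˡ (b ∷ []) (c ∷ []) (mul a (eval p a)) ⟨
      mul (b ∷ []) (eval (c ∷ p) a)                                  ∎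

  eval-neg : ∀ p a → eval (neg p) a ≋ neg (eval p a)
  eval-neg p a = begin
    eval (neg p) a                        ≈⟨ eval-congˡ a (neg-as-mul p) ⟩
    eval (mul (neg one) p) a              ≈⟨ eval-mul (neg one) p a ⟩
    mul (eval (neg one) a) (eval p a)     ≈⟨ mul-congˡ (eval p a) (eval-const (⊖ 𝟙) a) ⟩
    mul (neg one) (eval p a)              ≈⟨ neg-as-mul (eval p a) ⟨
    neg (eval p a)                        ∎
    where
    open ≋-Reasoning
    neg-as-mul : ∀ q → neg q ≋ mul (neg one) q
    neg-as-mul q = ≋-sym (≋-trans (neg-mul one q) (neg-cong (mul-identityˡ q)))

  eval-monomial : ∀ n a → eval (List.replicate n 𝟘 ++ (𝟙 ∷ [])) a ≋ pow a n
  eval-monomial zero    a = eval-one a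
  eval-monomial (suc n) a = ≋-trans (add-zeroˡ _) (mul-congʳ a (eval-monomial n a))

  pow-minus-one-odd : ∀ k → pow (neg one) (suc (k + k)) ≋ neg one
  pow-minus-one-odd zero    = ≋-trans (mul-comm (neg one) one) (mul-identityˡ (neg one))
  pow-minus-one-odd (suc k) = begin
    pow (neg one) (suc (suc k + suc k))                   ≡⟨ cong (λ z → pow (neg one) (suc (suc z))) (+-suc k k) ⟩
    mul (neg one) (mul (neg one) (pow (neg one) (suc (k + k))))
      ≈⟨ mul-congʳ (neg one) (mul-congʳ (neg one) (pow-minus-one-odd k)) ⟩
    mul (neg one) (mul (neg one) (neg one))
      ≈⟨ mul-congʳ (neg one) (≋-trans (neg-mul one (neg one)) (≋-trans (neg-cong (mul-identityˡ (neg one))) (neg-involutive one))) ⟩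
    mul (neg one) one                                      ≈⟨ mul-identityʳ (neg one) ⟩
    neg one                                                ∎
    where open ≋-Reasoning

  C-difference : ∀ h {a b d} → add a (neg b) ≋ d → Cong h d [] → Cong h a b
  C-difference h e (cg w f) = cg w (≋-trans e (≋-trans (≋-sym (add-identityʳ _)) f))

  root-of-multiple : ∀ h X c f g y → Cong X c (mul f g) → Cong h (eval X y) [] → Cong h (eval g y) [] → Cong h (eval c y) []
  root-of-multiple h X c f g y (cg Q e) X[y]≡0 g[y]≡0 =
    C-trans h (C-difference h difference (C-absorb h (eval Q y) X[y]≡0))
              (C-resp h (≋-sym (eval-mul f g y)) ≋-refl (C-absorb h (eval f y) g[y]≡0))
    where
    open ≋-Reasoning
    difference : add (eval c y) (neg (eval (mul f g) y)) ≋ mul (eval Q y) (eval X y)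
    difference = begin
      add (eval c y) (neg (eval (mul f g) y))    ≈⟨ add-cong ≋-refl (eval-neg (mul f g) y) ⟨
      add (eval c y) (eval (neg (mul f g)) y)    ≈⟨ eval-add c (neg (mul f g)) y ⟨
      eval (add c (neg (mul f g))) y             ≈⟨ eval-congˡ y e ⟩
      eval (mul Q X) y                           ≈⟨ eval-mul Q X y ⟩
      mul (eval Q y) (eval X y)                  ∎

-- ℤ₄ as a coefficient ring.  Its ring laws are finitely many equations between elements of
-- ℤ₄; each is verified by evaluating a decision procedure over all elements.
fromℕ₄-toℕ₄ : ∀ x → fromℕ₄ (toℕ₄ x) ≡ x
fromℕ₄-toℕ₄ z0 = refl
fromℕ₄-toℕ₄ z1 = refl
fromℕ₄-toℕ₄ z2 = refl
fromℕ₄-toℕ₄ z3 = refl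

infix 4 _≟₄_
_≟₄_ : DecidableEquality ℤ₄
x ≟₄ y = map′ injective (cong toℕ₄) (toℕ₄ x ℕ.≟ toℕ₄ y)
  where
  injective : toℕ₄ x ≡ toℕ₄ y → x ≡ y
  injective e = trans (sym (fromℕ₄-toℕ₄ x)) (trans (cong fromℕ₄ e) (fromℕ₄-toℕ₄ y))

∀₄? : {P : ℤ₄ → Set} → (∀ x → Dec (P x)) → Dec (∀ x → P x)
∀₄? {P} P? = map′ every (λ f → f z0 , f z1 , f z2 , f z3) (P? z0 ×-dec P? z1 ×-dec P? z2 ×-dec P? z3)
  where
  every : P z0 × P z1 × P z2 × P z3 → ∀ x → P x
  every (p , _ , _ , _) z0 = p
  every (_ , p , _ , _) z1 = p
  every (_ , _ , p , _) z2 = p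
  every (_ , _ , _ , p) z3 = p

by-cases₁ : {P : ℤ₄ → Set} (P? : ∀ x → Dec (P x)) → From-yes (∀₄? P?)
by-cases₁ P? = from-yes (∀₄? P?)

by-cases₂ : {P : ℤ₄ → ℤ₄ → Set} (P? : ∀ x y → Dec (P x y)) → From-yes (∀₄? λ x → ∀₄? (P? x))
by-cases₂ P? = from-yes (∀₄? λ x → ∀₄? (P? x))

by-cases₃ : {P : ℤ₄ → ℤ₄ → ℤ₄ → Set} (P? : ∀ x y z → Dec (P x y z)) → From-yes (∀₄? λ x → ∀₄? λ y → ∀₄? (P? x y))
by-cases₃ P? = from-yes (∀₄? λ x → ∀₄? λ y → ∀₄? (P? x y))

ℤ₄-isCommutativeRing : IsCommutativeRing _≡_ _+₄_ _*₄_ -₄_ z0 z1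
ℤ₄-isCommutativeRing = record
  { isRing = record
    { +-isAbelianGroup = record
      { isGroup = record
        { isMonoid = record
          { isSemigroup = record
            { isMagma = record { isEquivalence = isEquivalence ; ∙-cong = cong₂ _+₄_ }
            ; assoc = by-cases₃ (λ x y z → (x +₄ y) +₄ z ≟₄ x +₄ (y +₄ z)) }
          ; identity = by-cases₁ (λ x → z0 +₄ x ≟₄ x) , by-cases₁ (λ x → x +₄ z0 ≟₄ x) }
        ; inverse = by-cases₁ (λ x → (-₄ x) +₄ x ≟₄ z0) , by-cases₁ (λ x → x +₄ (-₄ x) ≟₄ z0)
        ; ⁻¹-cong = cong -₄_ }
      ; comm = by-cases₂ (λ x y → x +₄ y ≟₄ y +₄ x) }
    ; *-cong = cong₂ _*₄_
    ; *-assoc = by-cases₃ (λ x y z → (x *₄ y) *₄ z ≟₄ x *₄ (y *₄ z))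
    ; *-identity = by-cases₁ (λ x → z1 *₄ x ≟₄ x) , by-cases₁ (λ x → x *₄ z1 ≟₄ x)
    ; distrib = by-cases₃ (λ x y z → x *₄ (y +₄ z) ≟₄ (x *₄ y) +₄ (x *₄ z))
              , by-cases₃ (λ x y z → (y +₄ z) *₄ x ≟₄ (y *₄ x) +₄ (z *₄ x)) }
  ; *-comm = by-cases₂ (λ x y → x *₄ y ≟₄ y *₄ x) }

ℤ₄-ring : CoefficientRing
ℤ₄-ring = record
  { A = ℤ₄ ; _⊕_ = _+₄_ ; _⊗_ = _*₄_ ; ⊖_ = -₄_ ; 𝟘 = z0 ; 𝟙 = z1
  ; isCommutativeRing = ℤ₄-isCommutativeRing
  ; zero? = λ { z0 → just refl ; _ → nothing } }

𝔽₂-ring : CoefficientRing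
𝔽₂-ring = record
  { A = Bool ; _⊕_ = _xor_ ; _⊗_ = _∧_ ; ⊖_ = id ; 𝟘 = false ; 𝟙 = true
  ; isCommutativeRing = CommutativeRing.isCommutativeRing xor-∧-commutativeRing
  ; zero? = λ { false → just refl ; true → nothing } }

module Z = Polynomials ℤ₄-ring
module B = Polynomials 𝔽₂-ring
module ZSolver = RingSolver Z.polyRing
module BSolver = RingSolver B.polyRing

addP≡ : ∀ p q → addP p q ≡ Z.add p q
addP≡ []      q       = refl
addP≡ (a ∷ p) []      = refl
addP≡ (a ∷ p) (b ∷ q) = cong (_ ∷_) (addP≡ p q)

mulP≡ : ∀ p q → mulP p q ≡ Z.mul p q
mulP≡ []      q = refl
mulP≡ (a ∷ p) q = trans (addP≡ (map (a *₄_) q) (z0 ∷ mulP p q)) (cong (λ r → Z.add (Z.scale a q) (z0 ∷ r)) (mulP≡ p q))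

powP≡ : ∀ a k → powP a k ≡ Z.pow a k
powP≡ a zero    = refl
powP≡ a (suc k) = trans (mulP≡ a (powP a k)) (cong (Z.mul a) (powP≡ a k))

evalP≡ : ∀ g a → evalP g a ≡ Z.eval g a
evalP≡ []      a = refl
evalP≡ (c ∷ g) a = trans (addP≡ (c ∷ []) (mulP a (evalP g a)))
  (cong (Z.add (c ∷ [])) (trans (mulP≡ a (evalP g a)) (cong (Z.mul a) (evalP≡ g a))))

coeff≡ : ∀ p i → coeff p i ≡ Z.co p i
coeff≡ []      i       = refl
coeff≡ (a ∷ p) zero    = refl
coeff≡ (a ∷ p) (suc i) = coeff≡ p i

coeff₂≡ : ∀ p i → coeff₂ p i ≡ B.co p i
coeff₂≡ []      i       = refl
coeff₂≡ (a ∷ p) zero    = refl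
coeff₂≡ (a ∷ p) (suc i) = coeff₂≡ p i

addP₂≡ : ∀ p q → addP₂ p q ≡ B.add p q
addP₂≡ []      q       = refl
addP₂≡ (a ∷ p) []      = refl
addP₂≡ (a ∷ p) (b ∷ q) = cong (_ ∷_) (addP₂≡ p q)

mulP₂≡ : ∀ p q → mulP₂ p q ≡ B.mul p q
mulP₂≡ []      q = refl
mulP₂≡ (a ∷ p) q = trans (addP₂≡ (map (a ∧_) q) (false ∷ mulP₂ p q)) (cong (λ r → B.add (B.scale a q) (false ∷ r)) (mulP₂≡ p q))

≈ₚ⇒≋ : ∀ {p q} → p ≈ₚ q → p Z.≋ q
≈ₚ⇒≋ {p} {q} e = Z.mk λ i → trans (sym (coeff≡ p i)) (trans (e i) (coeff≡ q i))

≋⇒≈ₚ : ∀ {p q} → p Z.≋ q → p ≈ₚ q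
≋⇒≈ₚ {p} {q} e i = trans (coeff≡ p i) (trans (Z.get e i) (sym (coeff≡ q i)))

mod⇒Cong : ∀ {a b h} → a ≡ b [mod h ] → Z.Cong h a b
mod⇒Cong {a} {b} {h} (q , e) = Z.cg q (Z.≋-trans (Z.≡⇒≋ (sym (addP≡ a (negP b)))) (Z.≋-trans (≈ₚ⇒≋ e) (Z.≡⇒≋ (mulP≡ q h))))

Cong⇒mod : ∀ {a b h} → Z.Cong h a b → a ≡ b [mod h ]
Cong⇒mod {a} {b} {h} (Z.cg q e) = q , ≋⇒≈ₚ (Z.≋-trans (Z.≡⇒≋ (addP≡ a (negP b))) (Z.≋-trans e (Z.≡⇒≋ (sym (mulP≡ q h)))))

red : List ℤ₄ → List Bool
red = map red₂

red₂-+ : ∀ a b → red₂ (a +₄ b) ≡ red₂ a xor red₂ b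
red₂-+ = by-cases₂ (λ a b → red₂ (a +₄ b) Bool.≟ red₂ a xor red₂ b)

red₂-* : ∀ a b → red₂ (a *₄ b) ≡ red₂ a ∧ red₂ b
red₂-* = by-cases₂ (λ a b → red₂ (a *₄ b) Bool.≟ red₂ a ∧ red₂ b)

red₂-- : ∀ a → red₂ (-₄ a) ≡ red₂ a
red₂-- = by-cases₁ (λ a → red₂ (-₄ a) Bool.≟ red₂ a)

co-red : ∀ p i → B.co (red p) i ≡ red₂ (Z.co p i)
co-red []      i       = refl
co-red (a ∷ p) zero    = refl
co-red (a ∷ p) (suc i) = co-red p i

red-cong : ∀ {p q} → p Z.≋ q → red p B.≋ red q
red-cong {p} {q} e = B.mk λ i → trans (co-red p i) (trans (cong red₂ (Z.get e i)) (sym (co-red q i)))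

red-add : ∀ p q → red (Z.add p q) B.≋ B.add (red p) (red q)
red-add p q = B.mk λ i → trans (co-red (Z.add p q) i) (trans (cong red₂ (Z.co-add p q i))
  (trans (red₂-+ (Z.co p i) (Z.co q i)) (trans (cong₂ _xor_ (sym (co-red p i)) (sym (co-red q i))) (sym (B.co-add (red p) (red q) i)))))

red-scale : ∀ a q → red (Z.scale a q) ≡ B.scale (red₂ a) (red q)
red-scale a []      = refl
red-scale a (b ∷ q) = cong₂ _∷_ (red₂-* a b) (red-scale a q)

red-neg : ∀ p → red (Z.neg p) ≡ B.neg (red p)
red-neg []      = refl
red-neg (a ∷ p) = cong₂ _∷_ (red₂-- a) (red-neg p)

red-mul : ∀ p q → red (Z.mul p q) B.≋ B.mul (red p) (red q)
red-mul []      q = B.≋-refl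
red-mul (a ∷ p) q = B.≋-trans (red-add (Z.scale a q) (z0 ∷ Z.mul p q))
  (B.add-cong (B.≡⇒≋ (red-scale a q)) (B.cons-cong refl (red-mul p q)))

red-pow : ∀ a k → red (Z.pow a k) B.≋ B.pow (red a) k
red-pow a zero    = B.≋-refl
red-pow a (suc k) = B.≋-trans (red-mul a (Z.pow a k)) (B.mul-congʳ (red a) (red-pow a k))

red-eval : ∀ g a → red (Z.eval g a) B.≋ B.eval (red g) (red a)
red-eval []      a = B.≋-refl
red-eval (c ∷ g) a = B.≋-trans (red-add (c ∷ []) (Z.mul a (Z.eval g a)))
  (B.add-cong B.≋-refl (B.≋-trans (red-mul a (Z.eval g a)) (B.mul-congʳ (red a) (red-eval g a))))

red-Cong : ∀ {h a b} → Z.Cong h a b → B.Cong (red h) (red a) (red b)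
red-Cong {h} {a} {b} (Z.cg q e) = B.cg (red q)
  (B.≋-trans (B.add-cong B.≋-refl (B.≡⇒≋ (sym (red-neg b))))
  (B.≋-trans (B.≋-sym (red-add a (Z.neg b)))
  (B.≋-trans (red-cong e) (red-mul q h))))

open B using (_≋_; mk; get; add; mul; scale; neg; one; pow; eval; co; ≋-refl; ≋-sym; ≋-trans; Cong)

HasDegree : List Bool → ℕ → Set
HasDegree r k = co r k ≡ true × (∀ i → k < i → co r i ≡ false)

DegreeBelow : List Bool → ℕ → Set
DegreeBelow s k = ∀ i → k ≤ i → co s i ≡ false

NonConstant : List Bool → Set
NonConstant u = ∃ λ i → 1 ≤ i × co u i ≡ true

degreeBelow-step : ∀ {s k} → DegreeBelow s (suc k) → co s k ≡ false → DegreeBelow s k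
degreeBelow-step b e i k≤i with m≤n⇒m<n∨m≡n k≤i
... | inj₁ k<i = b i k<i
... | inj₂ refl = e

degreeBelow-length : ∀ s → DegreeBelow s (length s)
degreeBelow-length []      i _ = refl
degreeBelow-length (a ∷ s) (suc i) (s≤s le) = degreeBelow-length s i le

degree-below : ∀ k s → DegreeBelow s k → (s ≋ []) ⊎ (Σ ℕ λ j → j < k × HasDegree s j)
degree-below zero    s b = inj₁ (mk λ i → b i z≤n)
degree-below (suc k) s b with co s k in eq
... | true  = inj₂ (k , ≤-refl , eq , λ i k<i → b i k<i)
... | false with degree-below k s (degreeBelow-step {s} b eq)
...   | inj₁ z = inj₁ z
...   | inj₂ (j , j<k , t) = inj₂ (j , <-trans j<k ≤-refl , t)

zero-or-degree : ∀ s → (s ≋ []) ⊎ (Σ ℕ λ j → HasDegree s j)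
zero-or-degree s with degree-below (length s) s (degreeBelow-length s)
... | inj₁ z = inj₁ z
... | inj₂ (j , _ , t) = inj₂ (j , t)

neg-self : ∀ p → neg p ≋ p
neg-self p = mk λ i → B.co-neg p i

move-summand : ∀ {x y z} → x ≋ add y z → z ≋ add x y
move-summand {x} {y} {z} e =
  ≋-trans (BSolver.solve 2 (λ y z → z ⊜ ((y :+ z) :+ y)) ≋-refl y z) (B.add-cong (≋-sym e) ≋-refl)
  where open BSolver using (_⊜_) renaming (_⊕_ to _:+_)

divide : ∀ r k → HasDegree r k → ∀ p → Σ (List Bool) λ q → Σ (List Bool) λ s → (p ≋ add (mul q r) s) × DegreeBelow s k
divide r k deg-r [] = [] , [] , ≋-refl , (λ i _ → refl)
divide r k deg-r (a ∷ p) with divide r k deg-r p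
... | q' , s' , e , bd with co (a ∷ s') k in eq
... | false = (false ∷ q') , (a ∷ s') ,
      ≋-trans (B.cons-cong refl e) (B.add-cong (≋-sym (B.add-cong (B.scale-zero r) ≋-refl)) ≋-refl) ,
      degreeBelow-step {a ∷ s'} (λ { (suc i) (s≤s le) → bd i le }) eq
... | true = (true ∷ q') , add (a ∷ s') r ,
      ≋-trans (B.cons-cong refl e)
        (≋-trans (BSolver.solve 3 (λ f t r → (f :+ t) ⊜ ((r :+ f) :+ (t :+ r))) ≋-refl (false ∷ mul q' r) (a ∷ s') r)
                 (≋-sym (B.add-cong (B.add-cong (B.scale-one r) ≋-refl) ≋-refl))) ,
      remainder-degree
  where
  open BSolver using (_⊜_) renaming (_⊕_ to _:+_)
  remainder-degree : DegreeBelow (add (a ∷ s') r) k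
  remainder-degree i k≤i with m≤n⇒m<n∨m≡n k≤i
  ... | inj₁ k<i = trans (B.co-add (a ∷ s') r i) (cong₂ _xor_ (shifted i k<i) (proj₂ deg-r i k<i))
    where
    shifted : ∀ i → k < i → co (a ∷ s') i ≡ false
    shifted (suc i) (s≤s le) = bd i le
  ... | inj₂ refl = trans (B.co-add (a ∷ s') r k) (cong₂ _xor_ eq (proj₁ deg-r))

co-mul-cons : ∀ b q r i → co (mul (b ∷ q) r) (suc i) ≡ (b ∧ co r (suc i)) xor co (mul q r) i
co-mul-cons b q r i = trans (B.co-add (scale b r) (false ∷ mul q r) (suc i)) (cong (_xor co (mul q r) i) (B.co-scale b r (suc i)))

weight : List Bool → ℕ
weight [] = 0
weight (true ∷ p) = suc (weight p)
weight (false ∷ p) = weight p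

multiple-degree : ∀ {h m} → HasDegree h m → ∀ q → (∃ λ i → co q i ≡ true) → ∃ λ j → m ≤ j × co (mul q h) j ≡ true
multiple-degree deg-h [] (i , ())
multiple-degree {h} deg-h (b ∷ q) (i , ei) with zero-or-degree q
... | inj₂ (j , deg-q) with multiple-degree deg-h q (j , proj₁ deg-q)
...   | j' , m≤j' , e' = suc j' , ≤-trans m≤j' (n≤1+n j') ,
        trans (co-mul-cons b q h j') (trans (cong₂ (λ x y → (b ∧ x) xor y) (proj₂ deg-h (suc j') (s≤s m≤j')) e') (vanish b))
        where
        vanish : ∀ b → (b ∧ false) xor true ≡ true
        vanish false = refl
        vanish true  = refl
multiple-degree {h} {m} deg-h (b ∷ q) (i , ei) | inj₁ q≋0 =
  m , ≤-refl , trans (get (B.mul-constˡ b h q≋0) m) (trans (B.co-scale b h m) (cong₂ _∧_ (head-true i ei) (proj₁ deg-h)))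
  where
  head-true : ∀ i → co (b ∷ q) i ≡ true → b ≡ true
  head-true zero    e = e
  head-true (suc i) e with trans (sym e) (get q≋0 i)
  ... | ()

cancel-degree : ∀ {h m} → HasDegree h m → ∀ q → mul q h ≋ [] → q ≋ []
cancel-degree deg-h q e with zero-or-degree q
... | inj₁ q≋0 = q≋0
... | inj₂ (j , deg-q) with multiple-degree deg-h q (j , proj₁ deg-q)
...   | j' , _ , e' with trans (sym e') (get e j')
...     | ()

NonZero : List Bool → List Bool → Set
NonZero h a = ¬ Cong h a []

-- For h̄ irreducible of degree m ≥ 1,  𝔽₂[x]/⟨h̄⟩  is a field; the argument needs only that it
-- is a nontrivial ring without zero divisors, which follows from Euclid's algorithm.
module ResidueField (hb : List Bool) (m : ℕ) (m≥1 : 1 ≤ m) (deg-h : HasDegree hb m)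
    (irreducible : ¬ (∃ λ u → ∃ λ v → NonConstant u × NonConstant v × (∀ i → co (mul u v) i ≡ co hb i))) where

  one-nonzero : NonZero hb one
  one-nonzero (B.cg q e) with zero-or-degree q
  ... | inj₁ q≋0 with trans (get e 0) (get (B.mul-zeroˡ hb q≋0) 0)
  ...   | ()
  one-nonzero (B.cg q e) | inj₂ (j , deg-q) with multiple-degree deg-h q (j , proj₁ deg-q)
  ...   | j' , m≤j' , e' = above-constant j' (≤-trans m≥1 m≤j') (trans (get e j') e')
    where
    above-constant : ∀ j → 1 ≤ j → co (add one (neg [])) j ≡ true → ⊥
    above-constant (suc j) _ ()

  cofactor-nonconstant : ∀ q r {j} → j < m → HasDegree r j → hb ≋ mul q r → NonConstant q
  cofactor-nonconstant [] r j<m deg-r e with trans (sym (proj₁ deg-h)) (get e m)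
  ... | ()
  cofactor-nonconstant (c ∷ q') r {j} j<m deg-r e with zero-or-degree q'
  ... | inj₂ (j' , deg-q') = suc j' , s≤s z≤n , proj₁ deg-q'
  ... | inj₁ q'≋0 = ⊥-elim (impossible c (begin
      true                   ≡⟨ proj₁ deg-h ⟨
      co hb m                ≡⟨ get (≋-trans e (B.mul-constˡ c r q'≋0)) m ⟩
      co (scale c r) m       ≡⟨ B.co-scale c r m ⟩
      c ∧ co r m             ≡⟨ cong (c ∧_) (proj₂ deg-r m j<m) ⟩
      c ∧ false              ∎))
    where
    open ≡-Reasoning
    impossible : ∀ c → true ≡ c ∧ false → ⊥
    impossible false ()
    impossible true  ()

  h-multiple : ∀ b → Cong hb (mul hb b) []
  h-multiple b = B.C-resp hb (B.mul-comm b hb) ≋-refl (B.C-multiple hb b)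

  -- Euclid's algorithm: if  r·b ≡ 0  with  r  of degree j < m,  then  b ≡ 0.  Dividing h̄ by r
  -- leaves a remainder of smaller degree that still annihilates b, and a zero remainder would
  -- factor h̄.  (N bounds the number of division steps.)
  annihilated : ∀ N j r → j < N → j < m → HasDegree r j → ∀ b → Cong hb (mul r b) [] → Cong hb b []
  annihilated (suc N) zero r j<N j<m deg-r b e =
    B.C-resp hb (≋-trans (B.mul-congˡ b r≋1) (B.mul-identityˡ b)) ≋-refl e
    where
    r≋1 : r ≋ one
    r≋1 = mk λ { zero → proj₁ deg-r ; (suc i) → proj₂ deg-r (suc i) (s≤s z≤n) }
  annihilated (suc N) (suc j) r j<N j<m deg-r b e with divide r (suc j) deg-r hb
  ... | q , s , hq , bd with degree-below (suc j) s bd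
  ... | inj₂ (j' , j'<j , deg-s) =
        annihilated N j' s (<-≤-trans j'<j (≤-pred j<N)) (<-trans j'<j j<m) deg-s b sb≡0
    where
    sb≡0 : Cong hb (mul s b) []
    sb≡0 = B.C-resp hb
             (≋-sym (≋-trans (B.mul-congˡ b (move-summand hq)) (≋-trans (B.mul-distribʳ hb (mul q r) b) (B.add-cong ≋-refl (B.mul-assoc q r b)))))
             ≋-refl
             (B.C-add hb (h-multiple b) (B.C-absorb hb q e))
  ... | inj₁ s≋0 = ⊥-elim (irreducible
          (q , r , cofactor-nonconstant q r j<m deg-r h≋qr , (suc j , s≤s z≤n , proj₁ deg-r) , λ i → sym (get h≋qr i)))
    where
    h≋qr : hb ≋ mul q r
    h≋qr = ≋-trans hq (≋-trans (B.add-cong ≋-refl s≋0) (B.add-identityʳ _))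

  no-zero-divisors : ∀ a b → NonZero hb a → Cong hb (mul a b) [] → Cong hb b []
  no-zero-divisors a b a≢0 e with divide hb m deg-h a
  ... | q , s , aq , bd with degree-below m s bd
  ... | inj₁ s≋0 = ⊥-elim (a≢0 (B.cg q (≋-trans (B.add-identityʳ a) (≋-trans aq (≋-trans (B.add-cong ≋-refl s≋0) (B.add-identityʳ _))))))
  ... | inj₂ (j , j<m , deg-s) = annihilated (suc j) j s ≤-refl j<m deg-s b sb≡0
    where
    sb≡0 : Cong hb (mul s b) []
    sb≡0 = B.C-resp hb
             (≋-sym (≋-trans (B.mul-congˡ b (move-summand aq)) (≋-trans (B.mul-distribʳ a (mul q hb) b) (B.add-cong ≋-refl (B.mul-assoc q hb b)))))
             ≋-refl
             (B.C-add hb e (B.C-absorb hb q (h-multiple b)))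

  nonzero-mul : ∀ {a b} → NonZero hb a → NonZero hb b → NonZero hb (mul a b)
  nonzero-mul {a} {b} a≢0 b≢0 e = b≢0 (no-zero-divisors a b a≢0 e)

eval-square : ∀ g y → eval g (mul y y) ≋ mul (eval g y) (eval g y)
eval-square []      y = ≋-refl
eval-square (c ∷ g) y =
  ≋-trans (B.add-cong (idempotent c) (B.mul-congʳ (mul y y) (eval-square g y)))
          (BSolver.solve 3 (λ c y e → ((c :* c) :+ ((y :* y) :* (e :* e))) ⊜ ((c :+ (y :* e)) :* (c :+ (y :* e)))) ≋-refl (c ∷ []) y (eval g y))
  where
  open BSolver using (_⊜_) renaming (_⊕_ to _:+_; _⊗_ to _:*_)
  idempotent : ∀ c → (c ∷ []) ≋ mul (c ∷ []) (c ∷ [])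
  idempotent false = ≋-refl
  idempotent true  = ≋-refl

halve : ∀ s → Σ ℕ λ k → (s ≡ k + k) ⊎ (s ≡ suc (k + k))
halve zero = 0 , inj₁ refl
halve (suc s) with halve s
... | k , inj₁ e = k , inj₂ (cong suc e)
... | k , inj₂ e = suc k , inj₁ (trans (cong suc e) (cong suc (sym (+-suc k k))))

odd-index : ∀ k → 2 * suc k ∸ 1 ≡ suc (k + k)
odd-index k = trans (cong (λ z → k + suc z) (+-identityʳ k)) (+-suc k k)

-- A binary word vanishing at  y^(2i-1)  for  1 ≤ i ≤ t  vanishes at  y^s  for all  1 ≤ s ≤ 2t:
-- an even  s = 2k  reduces to  k  by the Frobenius map.  (N bounds the recursion depth.)
odd-zeros-suffice : ∀ hb y p t → (∀ i → 1 ≤ i → i ≤ t → Cong hb (eval p (pow y (2 * i ∸ 1))) []) →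
                    ∀ N s → s < N → 1 ≤ s → s ≤ 2 * t → Cong hb (eval p (pow y s)) []
odd-zeros-suffice hb y p t odd (suc N) s s<N 1≤s s≤2t with halve s
... | k , inj₂ refl = subst (λ z → Cong hb (eval p (pow y z)) []) (odd-index k) (odd (suc k) (s≤s z≤n) k<t)
  where
  k<t : suc k ≤ t
  k<t with suc k ≤? t
  ... | yes le = le
  ... | no nle = ⊥-elim (<⇒≱ (subst (suc (k + k) ≤_) (cong (t +_) (+-identityʳ t)) s≤2t) (+-mono-≤ t≤k t≤k))
    where
    t≤k : t ≤ k
    t≤k = ≤-pred (≰⇒> nle)
... | k , inj₁ refl = B.C-resp hb (≋-sym (≋-trans (B.eval-congʳ p (B.pow-add y k k)) (eval-square p (pow y k)))) ≋-refl
    (B.C-mul hb ek ek)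
  where
  positive-half : ∀ k → 1 ≤ k + k → 1 ≤ k
  positive-half (suc k) _ = s≤s z≤n
  k≥1 : 1 ≤ k
  k≥1 = positive-half k 1≤s
  ek : Cong hb (eval p (pow y k)) []
  ek = odd-zeros-suffice hb y p t odd N k (<-≤-trans (m<m+n k k≥1) (≤-pred s<N)) k≥1 (≤-trans (m≤m+n k k) s≤2t)

-- Power sums  Σ λ·βˢ  of a list of pairs (λ, β) in a ring  𝔽₂[x]/⟨h̄⟩  without zero divisors
-- cannot vanish for as many consecutive exponents as there are pairs, when the λ are nonzero
-- and the β are nonzero and pairwise distinct (the Vandermonde determinant is nonzero).
module PowerSums (hb : List Bool) (one-nonzero : NonZero hb one)
    (nonzero-mul : ∀ {a b} → NonZero hb a → NonZero hb b → NonZero hb (mul a b)) where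

  nonzero-pow : ∀ {a} k → NonZero hb a → NonZero hb (pow a k)
  nonzero-pow zero    a≢0 = one-nonzero
  nonzero-pow (suc k) a≢0 = nonzero-mul a≢0 (nonzero-pow k a≢0)

  Terms : Set
  Terms = List (List Bool × List Bool)

  powerSum : Terms → ℕ → List Bool
  powerSum [] s = []
  powerSum ((l , b) ∷ L) s = add (mul l (pow b s)) (powerSum L s)

  DistinctFrom : List Bool → Terms → Set
  DistinctFrom b [] = ⊤
  DistinctFrom b ((l , b') ∷ L) = NonZero hb (add b' b) × DistinctFrom b L

  Admissible : Terms → Set
  Admissible [] = ⊤
  Admissible ((l , b) ∷ L) = NonZero hb l × NonZero hb b × DistinctFrom b L × Admissible L

  -- eliminating the node b: the coefficient of β is multiplied by β - b
  eliminate : List Bool → Terms → Terms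
  eliminate b [] = []
  eliminate b ((l , b') ∷ L) = (mul l (add b' b) , b') ∷ eliminate b L

  eliminate-length : ∀ b L → length (eliminate b L) ≡ length L
  eliminate-length b [] = refl
  eliminate-length b ((l , b') ∷ L) = cong suc (eliminate-length b L)

  powerSum-eliminate : ∀ b L s → powerSum (eliminate b L) s ≋ add (powerSum L (suc s)) (mul b (powerSum L s))
  powerSum-eliminate b [] s = ≋-sym (B.mul-zeroʳ b)
  powerSum-eliminate b ((l , b') ∷ L) s =
    ≋-trans (B.add-cong ≋-refl (powerSum-eliminate b L s))
      (BSolver.solve 6 (λ l b' b P A₁ A₀ → (((l :* (b' :+ b)) :* P) :+ (A₁ :+ (b :* A₀)))
                                         ⊜ (((l :* (b' :* P)) :+ A₁) :+ (b :* ((l :* P) :+ A₀))))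
        ≋-refl l b' b (pow b' s) (powerSum L (suc s)) (powerSum L s))
    where open BSolver using (_⊜_) renaming (_⊕_ to _:+_; _⊗_ to _:*_)

  -- the term of b itself disappears from  S(s+1) + b·S(s)
  head-cancels : ∀ l b P A₁ A₀ → add A₁ (mul b A₀) ≋ add (add (mul l (mul b P)) A₁) (mul b (add (mul l P) A₀))
  head-cancels = BSolver.solve 5 (λ l b P A₁ A₀ → (A₁ :+ (b :* A₀)) ⊜ (((l :* (b :* P)) :+ A₁) :+ (b :* ((l :* P) :+ A₀)))) ≋-refl
    where open BSolver using (_⊜_) renaming (_⊕_ to _:+_; _⊗_ to _:*_)

  distinct-eliminate : ∀ b b' L → DistinctFrom b' L → DistinctFrom b' (eliminate b L)
  distinct-eliminate b b' [] d = tt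
  distinct-eliminate b b' ((l , c) ∷ L) (c≢b' , d) = c≢b' , distinct-eliminate b b' L d

  admissible-eliminate : ∀ b L → DistinctFrom b L → Admissible L → Admissible (eliminate b L)
  admissible-eliminate b [] d g = tt
  admissible-eliminate b ((l , c) ∷ L) (c≢b , d) (l≢0 , c≢0 , dc , g) =
    nonzero-mul l≢0 c≢b , c≢0 , distinct-eliminate b c L dc , admissible-eliminate b L d g

  power-sums-nonvanishing : ∀ r N x L → length L < N → Admissible (x ∷ L) →
                            (∀ s → r ≤ s → s ≤ r + length L → Cong hb (powerSum (x ∷ L) s) []) → ⊥
  power-sums-nonvanishing r (suc N) (l , b) [] _ (l≢0 , b≢0 , _) z =
    nonzero-mul l≢0 (nonzero-pow r b≢0) (B.C-resp hb (B.add-identityʳ (mul l (pow b r))) ≋-refl (z r ≤-refl (m≤m+n r 0)))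
  power-sums-nonvanishing r (suc N) (l , b) ((l' , b') ∷ L) (s≤s len<N) (l≢0 , b≢0 , dist , adm) z =
    power-sums-nonvanishing r N (mul l' (add b' b) , b') (eliminate b L)
      (subst (_< N) (sym (eliminate-length b L)) len<N) (admissible-eliminate b ((l' , b') ∷ L) dist adm) z'
    where
    L₀ = (l' , b') ∷ L
    z' : ∀ s → r ≤ s → s ≤ r + length (eliminate b L) → Cong hb (powerSum (eliminate b L₀) s) []
    z' s r≤s s≤ = B.C-resp hb
        (≋-sym (≋-trans (powerSum-eliminate b L₀ s) (head-cancels l b (pow b s) (powerSum L₀ (suc s)) (powerSum L₀ s)))) ≋-refl
        (B.C-add hb (z (suc s) (≤-trans r≤s (n≤1+n s)) (subst (suc s ≤_) (sym (+-suc r (length L))) (s≤s s≤')))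
                    (B.C-absorb hb b (z s r≤s (≤-trans s≤' (+-monoʳ-≤ r (n≤1+n (length L)))))))
      where
      s≤' : s ≤ r + length L
      s≤' = subst (λ k → s ≤ r + k) (eliminate-length b L) s≤

  -- The nonzero letters
  -- of the word give the pairs  (1, yʲ), whose power sums are the values  p(yˢ).
  module BCHBound (y : List Bool) (n : ℕ) (n≥1 : 1 ≤ n) (yⁿ≡1 : Cong hb (pow y n) one)
                  (order : ∀ d → 1 ≤ d → d < n → ¬ Cong hb (pow y d) one) where

    y-nonzero : NonZero hb y
    y-nonzero y≡0 = one-nonzero (B.C-trans hb (B.C-sym hb yⁿ≡1) (yⁿ≡0 n≥1))
      where
      yⁿ≡0 : 1 ≤ n → Cong hb (pow y n) []
      yⁿ≡0 (s≤s {n = n'} z≤n) = B.C-mul hb y≡0 (B.C-refl hb {pow y n'})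

    -- the powers  y⁰, …, y^(n-1)  are pairwise distinct:  yʲ - yⁱ = yⁱ (y^(j-i) - 1)
    distinct-powers : ∀ i j → i < j → j < n → NonZero hb (add (pow y j) (pow y i))
    distinct-powers i j i<j j<n z = nonzero-mul (nonzero-pow i y-nonzero) yᵈ≢1 (B.C-resp hb factor ≋-refl z)
      where
      d = j ∸ i
      i+d≡j : i + d ≡ j
      i+d≡j = m+[n∸m]≡n (<⇒≤ i<j)
      d≥1 : 1 ≤ d
      d≥1 with d | i+d≡j
      ... | zero  | e = ⊥-elim (<-irrefl (trans (sym (+-identityʳ i)) e) i<j)
      ... | suc _ | _ = s≤s z≤n
      d<n : d < n
      d<n = ≤-<-trans (m≤n+m d i) (subst (_< n) (sym i+d≡j) j<n)
      yᵈ≢1 : NonZero hb (add (pow y d) one)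
      yᵈ≢1 (B.cg w e) = order d d≥1 d<n (B.cg w (≋-trans (≋-sym (B.add-identityʳ (add (pow y d) one))) e))
      factor : add (pow y j) (pow y i) ≋ mul (pow y i) (add (pow y d) one)
      factor = ≋-trans (B.add-cong (≋-trans (B.≡⇒≋ (cong (pow y) (sym i+d≡j))) (B.pow-add y i d)) ≋-refl)
                       (BSolver.solve 2 (λ P Q → ((P :* Q) :+ P) ⊜ (P :* (Q :+ Κ one))) ≋-refl (pow y i) (pow y d))
        where open BSolver using (_⊜_; Κ) renaming (_⊕_ to _:+_; _⊗_ to _:*_)

    support : List Bool → ℕ → Terms
    support [] j = []
    support (true ∷ p) j = (one , pow y j) ∷ support p (suc j)
    support (false ∷ p) j = support p (suc j)

    support-length : ∀ p j → length (support p j) ≡ weight p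
    support-length [] j = refl
    support-length (true ∷ p) j = cong suc (support-length p (suc j))
    support-length (false ∷ p) j = support-length p (suc j)

    support-distinct : ∀ p j k → k < j → j + length p ≤ n → DistinctFrom (pow y k) (support p j)
    support-distinct [] j k k<j le = tt
    support-distinct (true ∷ p) j k k<j le =
      distinct-powers k j k<j (<-≤-trans (m<m+n j (s≤s z≤n)) le) ,
      support-distinct p (suc j) k (<-trans k<j ≤-refl) (subst (_≤ n) (+-suc j (length p)) le)
    support-distinct (false ∷ p) j k k<j le =
      support-distinct p (suc j) k (<-trans k<j ≤-refl) (subst (_≤ n) (+-suc j (length p)) le)

    support-admissible : ∀ p j → j + length p ≤ n → Admissible (support p j)
    support-admissible [] j le = tt
    support-admissible (true ∷ p) j le =
      one-nonzero , nonzero-pow j y-nonzero , support-distinct p (suc j) j ≤-refl le' , support-admissible p (suc j) le'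
      where le' = subst (_≤ n) (+-suc j (length p)) le
    support-admissible (false ∷ p) j le = support-admissible p (suc j) (subst (_≤ n) (+-suc j (length p)) le)

    powerSum-support : ∀ p j s → powerSum (support p j) s ≋ mul (pow (pow y s) j) (eval p (pow y s))
    powerSum-support [] j s = ≋-sym (B.mul-zeroʳ (pow (pow y s) j))
    powerSum-support (true ∷ p) j s =
      ≋-trans (B.add-cong (B.mul-congʳ one (B.pow-pow-comm y j s)) (powerSum-support p (suc j) s))
        (BSolver.solve 3 (λ Y x e → ((Κ one :* Y) :+ ((x :* Y) :* e)) ⊜ (Y :* (Κ one :+ (x :* e)))) ≋-refl
           (pow (pow y s) j) (pow y s) (eval p (pow y s)))
      where open BSolver using (_⊜_; Κ) renaming (_⊕_ to _:+_; _⊗_ to _:*_)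
    powerSum-support (false ∷ p) j s =
      ≋-trans (powerSum-support p (suc j) s)
        (≋-trans (BSolver.solve 3 (λ Y x e → ((x :* Y) :* e) ⊜ (Y :* (x :* e))) ≋-refl (pow (pow y s) j) (pow y s) (eval p (pow y s)))
                 (B.mul-congʳ (pow (pow y s) j) (≋-sym (B.add-zeroˡ _))))
      where open BSolver using (_⊜_) renaming (_⊗_ to _:*_)

    bch-bound : ∀ p → length p ≤ n → 1 ≤ weight p → (∀ s → 1 ≤ s → s ≤ weight p → Cong hb (eval p (pow y s)) []) → ⊥
    bch-bound p len w≥1 zeros with support p 0 | support-length p 0 | support-admissible p 0 len | powerSum-support p 0
    ... | [] | e | _ | _ = ⊥-elim (empty-support w≥1 e)
      where
      empty-support : 1 ≤ weight p → 0 ≡ weight p → ⊥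
      empty-support le e with weight p
      empty-support () refl | .0
    ... | x ∷ L | e | adm | sums = power-sums-nonvanishing 1 (suc (length L)) x L ≤-refl adm zeros'
      where
      zeros' : ∀ s → 1 ≤ s → s ≤ 1 + length L → Cong hb (powerSum (x ∷ L) s) []
      zeros' s 1≤s s≤ = B.C-resp hb (≋-sym (≋-trans (sums s) (B.mul-identityˡ _))) ≋-refl (zeros s 1≤s (subst (s ≤_) e s≤))

-- The even elements of ℤ₄ are the multiples of 2, so a polynomial
-- with zero reduction is 2 times its "half"; hence a congruence modulo h̄ lifts to a congruence
-- modulo h up to a multiple of 2, and multiples of 2 square to 0 since 4 = 0 in ℤ₄.
two : List ℤ₄
two = z2 ∷ []

lift₂ : Bool → ℤ₄
lift₂ false = z0
lift₂ true  = z1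

half : ℤ₄ → ℤ₄
half z2 = z1
half _  = z0

red-lift : ∀ q → red (map lift₂ q) ≡ q
red-lift [] = refl
red-lift (false ∷ q) = cong (false ∷_) (red-lift q)
red-lift (true ∷ q)  = cong (true ∷_) (red-lift q)

co-two : ∀ p i → Z.co (Z.mul two p) i ≡ z2 *₄ Z.co p i
co-two p i = trans (Z.co-add (Z.scale z2 p) (z0 ∷ []) i)
  (trans (cong₂ _+₄_ (Z.co-scale z2 p i) (Z.co-zero i)) (IsCommutativeRing.+-identityʳ ℤ₄-isCommutativeRing _))

co-half : ∀ p i → Z.co (map half p) i ≡ half (Z.co p i)
co-half [] i = refl
co-half (a ∷ p) zero = refl
co-half (a ∷ p) (suc i) = co-half p i

even-split : ∀ z → red z B.≋ [] → z Z.≋ Z.mul two (map half z)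
even-split z e = Z.mk λ i → trans (double-half (Z.co z i) (trans (sym (co-red z i)) (B.get e i)))
  (sym (trans (co-two (map half z) i) (cong (z2 *₄_) (co-half z i))))
  where
  double-half : ∀ x → red₂ x ≡ false → x ≡ z2 *₄ half x
  double-half z0 e = refl
  double-half z2 e = refl

two-annihilates : ∀ p → Z.mul two p Z.≋ [] → red p B.≋ []
two-annihilates p e = B.mk λ i → trans (co-red p i) (even (Z.co p i) (trans (sym (co-two p i)) (Z.get e i)))
  where
  even : ∀ x → z2 *₄ x ≡ z0 → red₂ x ≡ false
  even z0 e = refl
  even z2 e = refl

lift-congruence : ∀ h u v → B.Cong (red h) (red u) (red v) → Σ (List ℤ₄) λ y → Z.Cong h u (Z.add v (Z.mul two y))
lift-congruence h u v (B.cg q̄ e) = map half z , Z.cg L (begin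
    Z.add u (Z.neg (Z.add v (Z.mul two (map half z))))
      ≈⟨ Z.add-cong (Z.≋-refl {u}) (Z.neg-cong (Z.add-cong (Z.≋-refl {v}) (even-split z z̄≋0))) ⟨
    Z.add u (Z.neg (Z.add v z))
      ≈⟨ ZSolver.solve 4 (λ u v L h → (u :+ (:- (v :+ ((u :+ (:- v)) :+ (:- (L :* h)))))) ⊜ (L :* h)) Z.≋-refl u v L h ⟩
    Z.mul L h                                             ∎)
  where
  open Z.≋-Reasoning
  open ZSolver using (_⊜_) renaming (_⊕_ to _:+_; _⊗_ to _:*_; ⊝_ to :-_)
  L = map lift₂ q̄
  z = Z.add (Z.add u (Z.neg v)) (Z.neg (Z.mul L h))
  z̄≋0 : red z B.≋ []
  z̄≋0 = B.≋-trans (red-add (Z.add u (Z.neg v)) (Z.neg (Z.mul L h)))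
    (B.≋-trans (B.add-cong (B.≋-trans (red-add u (Z.neg v)) (B.add-cong B.≋-refl (B.≡⇒≋ (red-neg v))))
                           (B.≋-trans (B.≡⇒≋ (red-neg (Z.mul L h))) (B.≋-trans (neg-self _)
                             (B.≋-trans (red-mul L h) (B.mul-congˡ (red h) (B.≡⇒≋ (red-lift q̄)))))))
    (B.≋-trans (B.add-cong e (B.≋-sym (neg-self _))) (B.add-inverseʳ (B.mul q̄ (red h)))))

-- ū ≡ 1 (mod h̄)  implies  u² ≡ 1 (mod h),  since  (1 + 2y)² = 1 + 4y + 4y² = 1  over ℤ₄
square-of-lift : ∀ h u → B.Cong (red h) (red u) B.one → Z.Cong h (Z.mul u u) Z.one
square-of-lift h u ū≡1 with lift-congruence h u Z.one ū≡1
... | y , u≡1+2y = Z.C-resp h Z.≋-refl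
        (ZSolver.solve 1 (λ y → ((Κ Z.one :+ (Κ two :* y)) :* (Κ Z.one :+ (Κ two :* y))) ⊜ Κ Z.one) Z.≋-refl y)
        (Z.C-mul h u≡1+2y u≡1+2y)
  where open ZSolver using (_⊜_; Κ) renaming (_⊕_ to _:+_; _⊗_ to _:*_)

-- The Lee weight of a word over ℤ₄ bounds the Hamming weight of its reduction and the Hamming
-- weight of the reduction of its half (which records the positions of the entries 2).
weight-red≤lee : ∀ c → weight (red c) ≤ leeWeight c
weight-red≤lee [] = z≤n
weight-red≤lee (z0 ∷ c) = weight-red≤lee c
weight-red≤lee (z1 ∷ c) = s≤s (weight-red≤lee c)
weight-red≤lee (z2 ∷ c) = ≤-trans (weight-red≤lee c) (m≤n+m _ 2)
weight-red≤lee (z3 ∷ c) = s≤s (weight-red≤lee c)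

weight-half≤lee : ∀ c → weight (red (map half c)) ≤ leeWeight c
weight-half≤lee [] = z≤n
weight-half≤lee (z0 ∷ c) = weight-half≤lee c
weight-half≤lee (z1 ∷ c) = ≤-trans (weight-half≤lee c) (n≤1+n _)
weight-half≤lee (z2 ∷ c) = ≤-trans (s≤s (weight-half≤lee c)) (n≤1+n _)
weight-half≤lee (z3 ∷ c) = ≤-trans (weight-half≤lee c) (n≤1+n _)

weight-zero : ∀ p → weight p ≡ 0 → p B.≋ []
weight-zero [] e = B.≋-refl
weight-zero (false ∷ p) e = B.zero-cons (weight-zero p e)

zero-word : ∀ {n} (c : Vec ℤ₄ n) → weight (red (toList c)) ≡ 0 → weight (red (map half (toList c))) ≡ 0 → c ≡ replicate n z0
zero-word Vec.[] e f = refl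
zero-word (z0 Vec.∷ c) e f = cong (z0 Vec.∷_) (zero-word c e f)

module GaloisRing (m : ℕ) (m≥1 : 1 ≤ m) (h : List ℤ₄) (basic : BasicIrreducible h m) where

  hb : List Bool
  hb = red h

  deg-h : HasDegree hb m
  deg-h = trans (co-red h m) (cong red₂ (trans (sym (coeff≡ h m)) (proj₁ (proj₁ basic)))) ,
          λ i m<i → trans (co-red h i) (cong red₂ (trans (sym (coeff≡ h i)) (proj₂ (proj₁ basic) i m<i)))

  irreducible : ¬ (∃ λ u → ∃ λ v → NonConstant u × NonConstant v × (∀ i → co (mul u v) i ≡ co hb i))
  irreducible (u , v , (i , 1≤i , ui) , (j , 1≤j , vj) , uv≡h) = proj₂ (proj₂ basic)
    (u , v , (i , 1≤i , trans (coeff₂≡ u i) ui) , (j , 1≤j , trans (coeff₂≡ v j) vj) ,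
      λ k → trans (coeff₂≡ (mulP₂ u v) k) (trans (cong (λ z → co z k) (mulP₂≡ u v)) (trans (uv≡h k) (sym (coeff₂≡ hb k)))))

  open ResidueField hb m m≥1 deg-h irreducible public
  open PowerSums hb one-nonzero nonzero-mul public

  -- 2Y ≡ 0 (mod h)  implies  Ȳ ≡ 0 (mod h̄):  writing 2Y = Q·h, reduction gives Q̄·h̄ = 0, so
  -- Q = 2Q'  and  2(Y - Q'h) = 0,  whence  Ȳ = Q̄'·h̄.
  halve-congruence : ∀ Y → Z.Cong h (Z.mul two Y) [] → Cong hb (red Y) []
  halve-congruence Y (Z.cg Q e) = B.cg (red Q') (≋-trans (B.add-identityʳ (red Y)) (char2-equal Ȳ+Q̄'h̄≋0))
    where
    Q' = map half Q
    Q̄h̄≋0 : mul (red Q) hb ≋ []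
    Q̄h̄≋0 = ≋-trans (≋-sym (red-mul Q h)) (≋-trans (red-cong (Z.≋-sym e)) (≋-trans (red-cong (Z.add-identityʳ _))
             (≋-trans (red-mul two Y) (B.mul-zeroˡ {red two} (red Y) (B.zero-cons ≋-refl)))))
    Q≋2Q' : Q Z.≋ Z.mul two Q'
    Q≋2Q' = even-split Q (cancel-degree deg-h (red Q) Q̄h̄≋0)
    2[Y-Q'h]≋0 : Z.mul two (Z.add Y (Z.neg (Z.mul Q' h))) Z.≋ []
    2[Y-Q'h]≋0 = begin
      Z.mul two (Z.add Y (Z.neg (Z.mul Q' h)))
        ≈⟨ ZSolver.solve 3 (λ Y Q' h → ((Κ two) :* (Y :+ (:- (Q' :* h)))) ⊜ (((Κ two) :* Y) :+ (:- (((Κ two) :* Q') :* h)))) Z.≋-refl Y Q' h ⟩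
      Z.add (Z.mul two Y) (Z.neg (Z.mul (Z.mul two Q') h))
        ≈⟨ Z.add-cong (Z.≋-sym (Z.add-identityʳ _)) (Z.neg-cong (Z.mul-congˡ h (Z.≋-sym Q≋2Q'))) ⟩
      Z.add (Z.add (Z.mul two Y) []) (Z.neg (Z.mul Q h)) ≈⟨ Z.add-cong e Z.≋-refl ⟩
      Z.add (Z.mul Q h) (Z.neg (Z.mul Q h))            ≈⟨ Z.add-inverseʳ (Z.mul Q h) ⟩
      []                                               ∎
      where
      open Z.≋-Reasoning
      open ZSolver using (_⊜_; Κ) renaming (_⊕_ to _:+_; _⊗_ to _:*_; ⊝_ to :-_)
    Ȳ+Q̄'h̄≋0 : add (red Y) (mul (red Q') hb) ≋ []
    Ȳ+Q̄'h̄≋0 = ≋-trans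
      (B.add-cong ≋-refl (≋-trans (≋-sym (red-mul Q' h)) (≋-trans (≋-sym (neg-self _)) (≋-sym (B.≡⇒≋ (red-neg (Z.mul Q' h)))))))
                (≋-trans (≋-sym (red-add Y (Z.neg (Z.mul Q' h)))) (two-annihilates _ 2[Y-Q'h]≋0))
    char2-equal : ∀ {a b} → add a b ≋ [] → a ≋ b
    char2-equal {a} {b} e = ≋-sym (move-summand {[]} {a} {b} (≋-sym e))

  module Root (n : ℕ) (n≥1 : 1 ≤ n) (α : List ℤ₄) (αⁿ≡-1 : Z.Cong h (Z.pow α n) (Z.neg Z.one))
              (order : ∀ k → 1 ≤ k → k < 2 * n → ¬ Z.Cong h (Z.pow α k) Z.one) where

    ᾱ : List Bool
    ᾱ = red α

    ᾱⁿ≡1 : Cong hb (pow ᾱ n) one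
    ᾱⁿ≡1 = B.C-resp hb (red-pow α n) ≋-refl (red-Cong αⁿ≡-1)

    -- ᾱ has order n:  ᾱᵈ ≡ 1  lifts to  α^(2d) = (αᵈ)² ≡ 1,  and  2d < 2n
    ᾱ-order : ∀ d → 1 ≤ d → d < n → ¬ Cong hb (pow ᾱ d) one
    ᾱ-order d 1≤d d<n ᾱᵈ≡1 = order (2 * d) (≤-trans 1≤d (m≤m+n d _)) (*-monoʳ-< 2 d<n)
        (Z.C-resp h square≋ Z.≋-refl (square-of-lift h (Z.pow α d) (B.C-resp hb (≋-sym (red-pow α d)) ≋-refl ᾱᵈ≡1)))
      where
      square≋ : Z.mul (Z.pow α d) (Z.pow α d) Z.≋ Z.pow α (2 * d)
      square≋ = Z.≋-sym (Z.≋-trans (Z.≡⇒≋ (cong (λ e → Z.pow α (d + e)) (+-identityʳ d))) (Z.pow-add α d d))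

    open BCHBound ᾱ n n≥1 ᾱⁿ≡1 ᾱ-order public

    designed-distance : ∀ p t → length p ≤ n → (∀ i → 1 ≤ i → i ≤ t → Cong hb (eval p (pow ᾱ (2 * i ∸ 1))) []) →
                        1 ≤ weight p → 2 * t < weight p
    designed-distance p t len odd-zeros w≥1 with weight p ≤? 2 * t
    ... | no  w≰2t = ≰⇒> w≰2t
    ... | yes w≤2t = ⊥-elim (bch-bound p len w≥1 λ s 1≤s s≤w →
            odd-zeros-suffice hb ᾱ p t odd-zeros (suc s) s ≤-refl 1≤s (≤-trans s≤w w≤2t))

    -- odd powers of α are roots of xⁿ + 1:  (α^(2k+1))ⁿ = (αⁿ)^(2k+1) ≡ (-1)^(2k+1) = -1
    odd-power-root : ∀ k → Z.Cong h (Z.eval (xⁿ+1 n) (Z.pow α (suc (k + k)))) []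
    odd-power-root k = Z.C-resp h (Z.≋-sym x[y]≋1+yⁿ) (Z.add-inverseʳ Z.one) (Z.C-add h (Z.C-refl h) yⁿ≡-1)
      where
      s = suc (k + k)
      y = Z.pow α s
      x[y]≋1+yⁿ : Z.eval (xⁿ+1 n) y Z.≋ Z.add Z.one (Z.pow y n)
      x[y]≋1+yⁿ = Z.≋-trans (Z.eval-congˡ y (Z.≡⇒≋ (addP≡ oneP (List.replicate n z0 ++ (z1 ∷ [])))))
                    (Z.≋-trans (Z.eval-add Z.one (List.replicate n z0 ++ (z1 ∷ [])) y) (Z.add-cong (Z.eval-one y) (Z.eval-monomial n y)))
      yⁿ≡-1 : Z.Cong h (Z.pow y n) (Z.neg Z.one)
      yⁿ≡-1 = Z.C-resp h (Z.≋-sym (Z.pow-pow-comm α s n)) (Z.pow-minus-one-odd k) (Z.C-pow h s αⁿ≡-1)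

    codeword-zeros : ∀ c f g t → Z.Cong (xⁿ+1 n) c (Z.mul f g) →
                     (∀ i → 1 ≤ i → i ≤ t → Z.Cong h (Z.eval g (Z.pow α (2 * i ∸ 1))) []) →
                     ∀ i → 1 ≤ i → i ≤ t → Z.Cong h (Z.eval c (Z.pow α (2 * i ∸ 1))) []
    codeword-zeros c f g t c≡fg g-zeros (suc k) 1≤i i≤t =
      Z.root-of-multiple h (xⁿ+1 n) c f g (Z.pow α (2 * suc k ∸ 1)) c≡fg
        (subst (λ s → Z.Cong h (Z.eval (xⁿ+1 n) (Z.pow α s)) []) (sym (odd-index k)) (odd-power-root k))
        (g-zeros (suc k) 1≤i i≤t)

    reduce-zero : ∀ c s → Z.Cong h (Z.eval c (Z.pow α s)) [] → Cong hb (eval (red c) (pow ᾱ s)) []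
    reduce-zero c s z = B.C-resp hb (≋-trans (red-eval c (Z.pow α s)) (B.eval-congʳ (red c) (red-pow α s))) ≋-refl (red-Cong z)

    halve-zero : ∀ c s → red c ≋ [] → Z.Cong h (Z.eval c (Z.pow α s)) [] → Cong hb (eval (red (map half c)) (pow ᾱ s)) []
    halve-zero c s c̄≋0 z = B.C-resp hb (≋-trans (red-eval (map half c) y) (B.eval-congʳ (red (map half c)) (red-pow α s))) ≋-refl
      (halve-congruence (Z.eval (map half c) y) (Z.C-resp h c[y]≋2c'[y] Z.≋-refl z))
      where
      y = Z.pow α s
      c[y]≋2c'[y] : Z.eval c y Z.≋ Z.mul two (Z.eval (map half c) y)
      c[y]≋2c'[y] = Z.≋-trans (Z.eval-congˡ y (even-split c c̄≋0))
                    (Z.≋-trans (Z.eval-mul two (map half c) y) (Z.mul-congˡ _ (Z.eval-const z2 y)))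

    -- A nonzero word of length n vanishing at  α^(2i-1),  1 ≤ i ≤ t,  has Lee weight ≥ 2t+1:
    -- either c̄ ≠ 0 and the BCH bound applies to c̄, or c = 2c' with c̄' ≠ 0 and it applies to c̄'.
    lee-distance : ∀ (c : Vec ℤ₄ n) t → (∀ i → 1 ≤ i → i ≤ t → Z.Cong h (Z.eval (toList c) (Z.pow α (2 * i ∸ 1))) []) →
                   c ≢ replicate n z0 → 2 * t + 1 ≤ leeWeight (toList c)
    lee-distance c t zeros c≢0 = subst (_≤ leeWeight cl) (+-comm 1 (2 * t)) bound
      where
      cl = toList c
      half-c = map half cl
      len : ∀ {A : Set} (f : ℤ₄ → A) → length (map f cl) ≤ n
      len f = ≤-reflexive (trans (length-map f cl) (length-toList c))
      bound : suc (2 * t) ≤ leeWeight cl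
      bound with weight (red cl) in w̄
      ... | suc _ = ≤-trans (designed-distance (red cl) t (len red₂)
                      (λ i 1≤i i≤t → reduce-zero cl (2 * i ∸ 1) (zeros i 1≤i i≤t)) (subst (1 ≤_) (sym w̄) (s≤s z≤n)))
                    (weight-red≤lee cl)
      ... | zero with weight (red half-c) in w'
      ...   | zero  = ⊥-elim (c≢0 (zero-word c w̄ w'))
      ...   | suc _ = ≤-trans (designed-distance (red half-c) t
                                 (≤-trans (≤-reflexive (length-map red₂ half-c)) (len half))
                                 (λ i 1≤i i≤t → halve-zero cl (2 * i ∸ 1) (weight-zero (red cl) w̄) (zeros i 1≤i i≤t))
                                 (subst (1 ≤_) (sym w') (s≤s z≤n)))
                      (weight-half≤lee cl)

module Hypotheses (h α : List ℤ₄) where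

  pow-mod : ∀ k {b} → powP α k ≡ b [mod h ] → Z.Cong h (Z.pow α k) b
  pow-mod k e = Z.C-resp h (Z.≡⇒≋ (powP≡ α k)) Z.≋-refl (mod⇒Cong e)

  not-pow-mod : ∀ k → ¬ (powP α k ≡ oneP [mod h ]) → ¬ Z.Cong h (Z.pow α k) Z.one
  not-pow-mod k ¬e e = ¬e (Cong⇒mod (Z.C-resp h (Z.≡⇒≋ (sym (powP≡ α k))) Z.≋-refl e))

  root-mod : ∀ g k → evalP g (powP α k) ≡ zeroP [mod h ] → Z.Cong h (Z.eval g (Z.pow α k)) []
  root-mod g k e = Z.C-resp h (Z.≡⇒≋ (trans (evalP≡ g (powP α k)) (cong (Z.eval g) (powP≡ α k)))) Z.≋-refl (mod⇒Cong e)

code-mod : ∀ n f g c → c ≡ mulP f g [mod xⁿ+1 n ] → Z.Cong (xⁿ+1 n) c (Z.mul f g)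
code-mod n f g c e = Z.C-resp (xⁿ+1 n) Z.≋-refl (Z.≡⇒≋ (mulP≡ f g)) (mod⇒Cong e)

odd-positive : ∀ n → n % 2 ≡ 1 → 1 ≤ n
odd-positive (suc n) _ = s≤s z≤n

theorem3p2 : (m : ℕ) → 1 ≤ m → (h : Poly) → BasicIrreducible h m →
    (n : ℕ) → n % 2 ≡ 1 →
    (α : Poly) →
    powP α (2 * n) ≡ oneP [mod h ] →
    (∀ k → 1 ≤ k → k < 2 * n → ¬ (powP α k ≡ oneP [mod h ])) →
    powP α n ≡ negP oneP [mod h ] →
    (t : ℕ) → 1 ≤ t →
    (g : Poly) →
    (∀ i → 1 ≤ i → i ≤ t → evalP g (powP α (2 * i ∸ 1)) ≡ zeroP [mod h ]) →
    (c : Vec ℤ₄ n) → InNegacyclicCode n g (toList c) → c ≢ replicate n z0 →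
    2 * t + 1 ≤ leeWeight (toList c)
theorem3p2 m m≥1 h basic n n-odd α _ order αⁿ≡-1 t _ g g-zeros c (f , c≡fg) c≢0 =
  lee-distance c t (codeword-zeros (toList c) f g t (code-mod n f g (toList c) c≡fg)
                                   (λ i 1≤i i≤t → root-mod g (2 * i ∸ 1) (g-zeros i 1≤i i≤t)))
               c≢0
  where
  open Hypotheses h α
  open GaloisRing m m≥1 h basic
  open Root n (odd-positive n n-odd) α (pow-mod n αⁿ≡-1) (λ k 1≤k k<2n → not-pow-mod k (order k 1≤k k<2n))
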